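{- For every integer $w\geq0$, every real number $\alpha\geq3(\frac{3}{2})^{w}$, and every tree $T$ with $|E(T)|>\alpha$, there exists $W\subseteq V(T)$ with $|W|\leq w+1$ and a set $\mathcal{C}$ of $W$-subtrees of $T$ such that $$\alpha<\sum_{T'\in\mathcal{C}}|E(T')|\leq\Big(1+\Big(\frac{2}{3}\Big)^{w}\Big)\alpha.$$
   Context: For a forest $F$ and a set $W\subseteq V(F)$, a $W$-subtree of $F$ is a maximal subtree of $F$ in which the vertices of $W$ appear only as leaves (a leaf being a vertex of degree 1 in that subtree). Every edge of $F$ lies in a unique $W$-subtree of $F$.
   Formalization: The parameter α ranges over the rationals instead of the real numbers. -}

module Defs where

open import Data.Nat as ℕ using (ℕ; zero; suc; _<ᵇ_)
open import Data.Bool using (Bool; true; false; if_then_else_; _∧_)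
open import Data.Fin using (Fin; toℕ)
open import Data.Fin.Subset using (Subset; _∈_; _⊆_)
open import Data.List using (List; []; _∷_; map; allFin; length; take; _++_)
open import Data.Nat.ListAction using (sum)
open import Data.List.Relation.Unary.Unique.Propositional using (Unique)
open import Data.List.Relation.Unary.Linked using (Linked)
open import Data.Product using (Σ; _×_; ∃)
open import Data.Empty using (⊥)
open import Relation.Binary.PropositionalEquality using (_≡_)
open import Relation.Nullary using (¬_)
open import Data.Rational using (ℚ; 1ℚ; _*_)

_^ℚ_ : ℚ → ℕ → ℚ
q ^ℚ zero  = 1ℚ
q ^ℚ suc k = q * (q ^ℚ k)

record Graph (n : ℕ) : Set where
  constructor graph
  field
    verts : Subset n
    adj   : Fin n → Fin n → Bool
open Graph public

Adj : ∀ {n} → Graph n → Fin n → Fin n → Set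
Adj G u v = adj G u v ≡ true

record IsGraph {n} (G : Graph n) : Set where
  field
    symm    : ∀ u v → Adj G u v → Adj G v u
    irrefl  : ∀ v → ¬ Adj G v v
    endsIn  : ∀ u v → Adj G u v → (u ∈ verts G) × (v ∈ verts G)

edgeCount : ∀ {n} → Graph n → ℕ
edgeCount {n} G =
  sum (map (λ i → sum (map (λ j → if (toℕ i <ᵇ toℕ j) ∧ adj G i j then 1 else 0)
                          (allFin n)))
           (allFin n))

degree : ∀ {n} → Graph n → Fin n → ℕ
degree {n} G v = sum (map (λ j → if adj G v j then 1 else 0) (allFin n))

data Walk {n} (G : Graph n) : Fin n → Fin n → Set where
  here : ∀ {v} → Walk G v v
  step : ∀ {u w v} → Adj G u w → Walk G w v → Walk G u v

Connected : ∀ {n} → Graph n → Set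
Connected G = ∀ u v → u ∈ verts G → v ∈ verts G → Walk G u v

-- a cycle: at least 3 distinct vertices, consecutive ones adjacent, last adjacent to first
IsCycle : ∀ {n} → Graph n → List (Fin n) → Set
IsCycle G vs = (3 ℕ.≤ length vs) × Unique vs × Linked (Adj G) (vs ++ take 1 vs)

Acyclic : ∀ {n} → Graph n → Set
Acyclic G = ∀ vs → ¬ IsCycle G vs

record IsTree {n} (G : Graph n) : Set where
  field
    isGraph   : IsGraph G
    nonempty  : ∃ λ v → v ∈ verts G
    connected : Connected G
    acyclic   : Acyclic G

_≤G_ : ∀ {n} → Graph n → Graph n → Set
H ≤G G = (verts H ⊆ verts G) × (∀ u v → Adj H u v → Adj G u v)

IsSubtree : ∀ {n} → Graph n → Graph n → Set
IsSubtree G H = IsTree H × (H ≤G G)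

WOnlyLeaves : ∀ {n} → Subset n → Graph n → Set
WOnlyLeaves W H = ∀ v → v ∈ W → v ∈ verts H → degree H v ≡ 1

IsWSubtree : ∀ {n} → Graph n → Subset n → Graph n → Set
IsWSubtree F W H =
  IsSubtree F H × WOnlyLeaves W H ×
  (∀ H′ → IsSubtree F H′ → WOnlyLeaves W H′ → H ≤G H′ → H′ ≤G H)

totalEdges : ∀ {n} → List (Graph n) → ℕ
totalEdges Cs = sum (map edgeCount Cs)

-- Let t₀ = ⌊α⌋.  Descending from any vertex, stop at a vertex x whose child branches (the branches of T at x
-- away from the previous vertex) together have more than t₀ edges while each has at most t₀ + 1.  If one has
-- exactly t₀ + 1 edges it is the answer, with W = {x}.  Otherwise take whole child branches until the next one
-- would overshoot t₀ and cut into that one with the remaining budget t.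
--
-- A branch with β edges is cut as follows.  Descend inside it to a vertex x whose child branches have at most
-- ⌈β/2⌉ edges while together they keep at least ⌈β/2⌉.  The trunk, i.e. the part of the branch not separated
-- from its root by x, then has at most as many edges as the child branches together: either it fits into t
-- and the rest of the budget is filled from the child branches, or the child branches alone exceed t.  In both
-- cases the child branches are again taken whole until one overshoots, and that one is cut recursively.  Each
-- cut adds one vertex to W and at least halves the size of the branch being cut, so the total exceeds t₀ by at
-- most ⌈t₀/2⌉ iterated w times, which is at most (2/3)^w α since ⌈d/2⌉ ≤ 2d/3 for d ≥ 3 and (2/3)^w α ≥ 3.

module Submission where

open import Defs

module Combinatorial where
  open import Algebra.Properties.CommutativeSemigroup using (interchange)
  open import Data.Bool using (true; false; if_then_else_)
  open import Data.Bool.Properties using (T-≡)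
  open import Data.Empty using (⊥; ⊥-elim)
  open import Data.Fin using (Fin)
  open import Data.Fin.Base using () renaming (_<_ to _<ᶠ_)
  open import Data.Fin.Properties using (_≟_; any?) renaming (_<?_ to _<ᶠ?_; <-cmp to <ᶠ-cmp; <-asym to <ᶠ-asym)
  import Data.Fin.Subset as SS
  import Data.Fin.Subset.Properties as SSP
  open import Data.List using (List; []; _∷_; _++_; length; map; allFin)
  open import Data.List.Membership.Propositional using (_∈_; _∉_)
  open import Data.List.Membership.Propositional.Properties using (∈-allFin)
  open import Data.List.Properties using (map-cong; map-++)
  open import Data.List.Relation.Binary.Subset.Propositional using (_⊆_)
  open import Data.List.Relation.Unary.All as All using (All; []; _∷_)
  import Data.List.Relation.Unary.All.Properties as AllP
  open import Data.List.Relation.Unary.AllPairs using (AllPairs; []; _∷_)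
  import Data.List.Relation.Unary.AllPairs.Properties as AllPairsP
  open import Data.List.Relation.Unary.Any using () renaming (here to hd; there to tl)
  open import Data.List.Relation.Unary.Linked as Linked using (Linked; [-]; _∷_)
  open import Data.List.Relation.Unary.Unique.Propositional using (Unique)
  open import Data.List.Relation.Unary.Unique.Propositional.Properties using (allFin⁺)
  open import Data.Nat using (ℕ; zero; suc; z≤n; s≤s; _+_; _≤_; _<_; ⌈_/2⌉; ⌊_/2⌋; _≤?_; _<?_)
  open import Data.Nat.Induction using (<-wellFounded)
  open import Data.Nat.ListAction using (sum)
  open import Data.Nat.ListAction.Properties using (sum-++)
  open import Data.Nat.Properties
    using (+-commutativeSemigroup; ≤-trans; ≤-reflexive; ≤-pred; ≤-antisym; <-≤-trans; ≮⇒≥; ≰⇒>; n≤1+n;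
           m≤m+n; m≤n+m; m≤n⇒∃[o]m+o≡n; +-suc; +-assoc; +-identityʳ; +-monoˡ-≤; +-monoʳ-≤; +-monoʳ-<;
           +-cancelˡ-<; +-cancelʳ-≤; ⌈n/2⌉-mono; ⌈n/2⌉<n; ⌊n/2⌋≤⌈n/2⌉; ⌊n/2⌋+⌈n/2⌉≡n; module ≤-Reasoning)
  open import Data.Product using (Σ; _×_; _,_; proj₁; proj₂; ∃; uncurry)
  open import Data.Sum using (_⊎_; inj₁; inj₂; [_,_]′)
  open import Data.Unit using (⊤; tt)
  open import Data.Vec using (tabulate; []; _∷_)
  open import Data.Vec.Properties using (lookup∘tabulate; lookup⇒[]=; []=⇒lookup)
  open import Function using (_∘_; id)
  open import Induction.WellFounded using (Acc; acc)
  open import Relation.Binary.Definitions using (tri<; tri≈; tri>)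
  open import Relation.Binary.PropositionalEquality
  open import Relation.Nullary using (¬_; Dec; yes; no; does; _because_)
  import Relation.Nullary.Decidable as Dec
  open import Relation.Nullary.Decidable using (T?; ¬?; ⊥-dec; _×-dec_; _⊎-dec_; map′; dec-true; dec-false)

  ⟦_⟧ : ∀ {p} {P : Set p} → Dec P → ℕ
  ⟦ p? ⟧ = if does p? then 1 else 0

  does⇒ : ∀ {p} {P : Set p} (p? : Dec P) → does p? ≡ true → P
  does⇒ (yes p) _ = p

  ∑ : ∀ {n} → (Fin n → ℕ) → ℕ
  ∑ f = sum (map f (allFin _))

  module _ {n : ℕ} where
    ∑-cong : {f g : Fin n → ℕ} → (∀ i → f i ≡ g i) → ∑ f ≡ ∑ g
    ∑-cong f≗g = cong sum (map-cong f≗g (allFin n))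

    ∑-zero : ∑ {n} (λ _ → 0) ≡ 0
    ∑-zero = go (allFin n)
      where go : ∀ xs → sum (map (λ _ → 0) xs) ≡ 0
            go []       = refl
            go (_ ∷ xs) = go xs

    ∑-+ : (f g : Fin n → ℕ) → ∑ (λ i → f i + g i) ≡ ∑ f + ∑ g
    ∑-+ f g = go (allFin n)
      where go : ∀ xs → sum (map (λ i → f i + g i) xs) ≡ sum (map f xs) + sum (map g xs)
            go []       = refl
            go (x ∷ xs) = trans (cong (f x + g x +_) (go xs)) (interchange +-commutativeSemigroup (f x) (g x) _ _)

    ∑-if : ∀ b (f : Fin n → ℕ) → ∑ (λ i → if b then f i else 0) ≡ (if b then ∑ f else 0)
    ∑-if true  f = refl
    ∑-if false f = ∑-zero

    ∑-comm : (f : Fin n → Fin n → ℕ) → ∑ (λ i → ∑ λ j → f i j) ≡ ∑ (λ j → ∑ λ i → f i j)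
    ∑-comm f = go (allFin n)
      where go : ∀ xs → sum (map (λ i → ∑ λ j → f i j) xs) ≡ ∑ (λ j → sum (map (λ i → f i j) xs))
            go []       = sym ∑-zero
            go (x ∷ xs) = trans (cong (∑ (f x) +_) (go xs)) (sym (∑-+ (f x) _))

    ≤∑ : (f : Fin n → ℕ) (i : Fin n) → f i ≤ ∑ f
    ≤∑ f i = go (allFin _) (∈-allFin i)
      where go : ∀ xs → i ∈ xs → f i ≤ sum (map f xs)
            go (x ∷ xs) (hd refl) = m≤m+n (f x) _
            go (x ∷ xs) (tl m)    = ≤-trans (go xs m) (m≤n+m _ (f x))

    ∑∑-split : (e u : Fin n → Fin n → ℕ) (f : Fin n → Fin n → Fin n → ℕ) →
               (∀ i j → e i j ≡ u i j + ∑ λ y → f y i j) →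
               (∑ λ i → ∑ (e i)) ≡ (∑ λ i → ∑ (u i)) + (∑ λ y → ∑ λ i → ∑ (f y i))
    ∑∑-split e u f e≡ = begin
      (∑ λ i → ∑ (e i))                                       ≡⟨ ∑-cong (λ i → ∑-cong (e≡ i)) ⟩
      (∑ λ i → ∑ λ j → u i j + ∑ λ y → f y i j)              ≡⟨ ∑-cong (λ i → ∑-+ (u i) _) ⟩
      (∑ λ i → ∑ (u i) + ∑ λ j → ∑ λ y → f y i j)            ≡⟨ ∑-+ _ _ ⟩
      (∑ λ i → ∑ (u i)) + (∑ λ i → ∑ λ j → ∑ λ y → f y i j)  ≡⟨ cong (_ +_) (∑-cong λ i → ∑-comm (λ j y → f y i j)) ⟩
      (∑ λ i → ∑ (u i)) + (∑ λ i → ∑ λ y → ∑ λ j → f y i j)  ≡⟨ cong (_ +_) (∑-comm (λ i y → ∑ (f y i))) ⟩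
      (∑ λ i → ∑ (u i)) + (∑ λ y → ∑ λ i → ∑ (f y i))        ∎
      where open ≡-Reasoning

    ∑∑-if : ∀ b (f : Fin n → Fin n → ℕ) →
            (∑ λ i → ∑ λ j → if b then f i j else 0) ≡ (if b then ∑ (λ i → ∑ (f i)) else 0)
    ∑∑-if b f = trans (∑-cong λ i → ∑-if b (f i)) (∑-if b _)

    module _ {p} {P : Fin n → Set p} (P? : ∀ i → Dec (P i)) where
      ∑⟦⟧≡0 : (∀ i → ¬ P i) → ∑ (⟦_⟧ ∘ P?) ≡ 0
      ∑⟦⟧≡0 ¬P = trans (∑-cong zero-term) ∑-zero
        where zero-term : ∀ i → ⟦ P? i ⟧ ≡ 0
              zero-term i = cong (λ b → if b then 1 else 0) (dec-false (P? i) (¬P i))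

      ∑⟦⟧≡1 : ∀ {i} → P i → (∀ {j} → P j → j ≡ i) → ∑ (⟦_⟧ ∘ P?) ≡ 1
      ∑⟦⟧≡1 {i} pi only = go (allFin n) (allFin⁺ n) (∈-allFin i)
        where
        none : ∀ xs → i ∉ xs → sum (map (⟦_⟧ ∘ P?) xs) ≡ 0
        none []       _  = refl
        none (x ∷ xs) i∉ with P? x
        ... | yes px = ⊥-elim (i∉ (hd (sym (only px))))
        ... | no _   = none xs (i∉ ∘ tl)
        go : ∀ xs → Unique xs → i ∈ xs → sum (map (⟦_⟧ ∘ P?) xs) ≡ 1
        go (x ∷ xs) (x∉ ∷ u) m with P? x | m
        ... | yes _  | hd refl = cong suc (none xs λ m′ → All.lookup x∉ m′ refl)
        ... | yes px | tl m′   = ⊥-elim (All.lookup x∉ m′ (only px))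
        ... | no ¬px | hd refl = ⊥-elim (¬px pi)
        ... | no _   | tl m′   = go xs u m′

      ∑⟦⟧≡1⇒unique : ∀ {i j} → ∑ (⟦_⟧ ∘ P?) ≡ 1 → P i → P j → i ≡ j
      ∑⟦⟧≡1⇒unique {i} {j} one pi pj = go (allFin n) one (∈-allFin i) (∈-allFin j)
        where
        positive : ∀ {k} xs → k ∈ xs → P k → 1 ≤ sum (map (⟦_⟧ ∘ P?) xs)
        positive (x ∷ xs) m pk with P? x | m
        ... | yes _  | _       = s≤s z≤n
        ... | no ¬px | hd refl = ⊥-elim (¬px pk)
        ... | no _   | tl m′   = positive xs m′ pk
        overfull : ∀ {r} → 1 ≤ r → suc r ≢ 1
        overfull (s≤s _) ()
        go : ∀ xs → sum (map (⟦_⟧ ∘ P?) xs) ≡ 1 → i ∈ xs → j ∈ xs → i ≡ j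
        go (x ∷ xs) s mi mj with P? x | mi | mj
        ... | yes _  | hd refl | hd refl = refl
        ... | yes _  | tl mi′  | _       = ⊥-elim (overfull (positive xs mi′ pi) s)
        ... | yes _  | hd refl | tl mj′  = ⊥-elim (overfull (positive xs mj′ pj) s)
        ... | no ¬px | hd refl | _       = ⊥-elim (¬px pi)
        ... | no ¬px | tl _    | hd refl = ⊥-elim (¬px pj)
        ... | no _   | tl mi′  | tl mj′  = go xs s mi′ mj′


    ∑∑⟦⟧≡1 : ∀ {p} {E : Fin n → Fin n → Set p} (E? : ∀ i j → Dec (E i j)) {a b} → E a b →
             (∀ {i j} → E i j → i ≡ a × j ≡ b) → (∑ λ i → ∑ λ j → ⟦ E? i j ⟧) ≡ 1
    ∑∑⟦⟧≡1 E? {a} {b} eab only = trans (∑-cong row) (∑⟦⟧≡1 (_≟ a) refl id)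
      where row : ∀ i → (∑ λ j → ⟦ E? i j ⟧) ≡ ⟦ i ≟ a ⟧
            row i with i ≟ a
            ... | yes refl = ∑⟦⟧≡1 (E? a) eab (proj₂ ∘ only)
            ... | no i≢a   = ∑⟦⟧≡0 (E? i) λ j e → i≢a (proj₁ (only e))

    ⟦⟧-partition : ∀ {a b c} {A : Set a} {B : Set b} {C : Fin n → Set c}
                   (A? : Dec A) (B? : Dec B) (C? : ∀ y → Dec (C y)) →
                   (A → ¬ B → ∃ C) → (B → A) → (∀ {y} → C y → A) → (∀ {y} → B → ¬ C y) →
                   (∀ {y y′} → C y → C y′ → y ≡ y′) → ⟦ A? ⟧ ≡ ⟦ B? ⟧ + ∑ (⟦_⟧ ∘ C?)
    ⟦⟧-partition A? B? C? A⇒ B⇒A C⇒A B∩C C-unique with A? | B?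
    ... | yes _  | yes b  = cong suc (sym (∑⟦⟧≡0 C? λ _ → B∩C b))
    ... | yes a  | no ¬b  = let _ , cy = A⇒ a ¬b in sym (∑⟦⟧≡1 C? cy λ cy′ → C-unique cy′ cy)
    ... | no ¬a  | yes b  = ⊥-elim (¬a (B⇒A b))
    ... | no ¬a  | no _   = sym (∑⟦⟧≡0 C? λ _ → ¬a ∘ C⇒A)

  ⟦⟧-×-dec : ∀ {a b} {A : Set a} {B : Set b} (A? : Dec A) (B? : Dec B) →
             ⟦ A? ×-dec B? ⟧ ≡ (if does A? then ⟦ B? ⟧ else 0)
  ⟦⟧-×-dec (true  because _) B? = refl
  ⟦⟧-×-dec (false because _) B? = refl

  -- does (Adj? G u v) reduces to adj G u v, so indicator sums over Adj? are literally degrees and edge counts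
  Adj? : ∀ {n} (G : Graph n) u v → Dec (Adj G u v)
  Adj? G u v = Dec.map T-≡ (T? (adj G u v))

  module _ {n : ℕ} (G : Graph n) {S : Fin n → Set} (S? : ∀ v → Dec (S v)) where
    induced : Graph n
    induced = graph (tabulate (does ∘ S?)) λ u v → does (Adj? G u v ×-dec S? u ×-dec S? v)

    induced-adj⁻ : ∀ {u v} → Adj induced u v → Adj G u v × S u × S v
    induced-adj⁻ = does⇒ (Adj? G _ _ ×-dec S? _ ×-dec S? _)

    induced-adj⁺ : ∀ {u v} → Adj G u v → S u → S v → Adj induced u v
    induced-adj⁺ uv su sv = dec-true (Adj? G _ _ ×-dec S? _ ×-dec S? _) (uv , su , sv)

    induced-verts⁻ : ∀ {v} → v SS.∈ verts induced → S v
    induced-verts⁻ {v} m = does⇒ (S? v) (trans (sym (lookup∘tabulate (does ∘ S?) v)) ([]=⇒lookup m))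

    induced-verts⁺ : ∀ {v} → S v → v SS.∈ verts induced
    induced-verts⁺ {v} sv = lookup⇒[]= v _ (trans (lookup∘tabulate (does ∘ S?) v) (dec-true (S? v) sv))

    isGraph-induced : IsGraph G → IsGraph induced
    isGraph-induced isG = record
      { symm   = λ u v uv → let uv , su , sv = induced-adj⁻ uv in induced-adj⁺ (symm u v uv) sv su
      ; irrefl = λ v vv → irrefl v (proj₁ (induced-adj⁻ vv))
      ; endsIn = λ u v uv → let _ , su , sv = induced-adj⁻ uv in induced-verts⁺ su , induced-verts⁺ sv
      }
      where open IsGraph isG

  greedy-split : ∀ {a} {A : Set a} (wt : A → ℕ) t (ys : List A) → t < sum (map wt ys) →
                 ∃ λ pre → ∃ λ y → ∃ λ post → ∃ λ t′ →
                   ys ≡ pre ++ y ∷ post × sum (map wt pre) + t′ ≡ t × t′ < wt y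
  greedy-split wt t (y ∷ ys) t< with t <? wt y
  ... | yes t<y = [] , y , ys , t , refl , refl , t<y
  ... | no t≮y with m≤n⇒∃[o]m+o≡n (≮⇒≥ t≮y)
  ...   | t₁ , y+t₁≡t with greedy-split wt t₁ ys (+-cancelˡ-< (wt y) _ _ (subst (_< wt y + _) (sym y+t₁≡t) t<))
  ...     | pre , y₀ , post , t′ , ys≡ , pre+t′≡t₁ , t′< =
    y ∷ pre , y₀ , post , t′ , cong (y ∷_) ys≡ ,
    trans (+-assoc (wt y) _ t′) (trans (cong (wt y +_) pre+t′≡t₁) y+t₁≡t) , t′<

  Unique-++-∷⁻ : ∀ {a} {A : Set a} (xs : List A) {y ys} → Unique (xs ++ y ∷ ys) → Unique xs × y ∉ xs
  Unique-++-∷⁻ []       _         = [] , λ ()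
  Unique-++-∷⁻ (x ∷ xs) (x∉ ∷ u) with Unique-++-∷⁻ xs u | AllP.++⁻ xs x∉
  ... | u′ , y∉ | x∉xs , x∉yys = x∉xs ∷ u′ , λ { (hd refl) → All.head x∉yys refl ; (tl m) → y∉ m }

  ∣p∪q∣≤∣p∣+∣q∣ : ∀ {n} (p q : SS.Subset n) → SS.∣ p SS.∪ q ∣ ≤ SS.∣ p ∣ + SS.∣ q ∣
  ∣p∪q∣≤∣p∣+∣q∣ []          []          = z≤n
  ∣p∪q∣≤∣p∣+∣q∣ (true ∷ p)  (true ∷ q)  = s≤s (≤-trans (∣p∪q∣≤∣p∣+∣q∣ p q) (+-monoʳ-≤ SS.∣ p ∣ (n≤1+n _)))
  ∣p∪q∣≤∣p∣+∣q∣ (true ∷ p)  (false ∷ q) = s≤s (∣p∪q∣≤∣p∣+∣q∣ p q)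
  ∣p∪q∣≤∣p∣+∣q∣ (false ∷ p) (true ∷ q)  =
    ≤-trans (s≤s (∣p∪q∣≤∣p∣+∣q∣ p q)) (≤-reflexive (sym (+-suc SS.∣ p ∣ SS.∣ q ∣)))
  ∣p∪q∣≤∣p∣+∣q∣ (false ∷ p) (false ∷ q) = ∣p∪q∣≤∣p∣+∣q∣ p q

  totalEdges-++ : ∀ {n} (Gs Hs : List (Graph n)) → totalEdges (Gs ++ Hs) ≡ totalEdges Gs + totalEdges Hs
  totalEdges-++ Gs Hs = trans (cong sum (map-++ edgeCount Gs Hs)) (sum-++ (map edgeCount Gs) (map edgeCount Hs))

  ⌈_/2^_⌉ : ℕ → ℕ → ℕ
  ⌈ d /2^ zero  ⌉ = d
  ⌈ d /2^ suc k ⌉ = ⌈ ⌈ d /2⌉ /2^ k ⌉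

  ⌈/2^⌉-mono : ∀ k {a b} → a ≤ b → ⌈ a /2^ k ⌉ ≤ ⌈ b /2^ k ⌉
  ⌈/2^⌉-mono zero    a≤b = a≤b
  ⌈/2^⌉-mono (suc k) a≤b = ⌈/2^⌉-mono k (⌈n/2⌉-mono a≤b)

  ⌈1/2^k⌉≡1 : ∀ k → ⌈ 1 /2^ k ⌉ ≡ 1
  ⌈1/2^k⌉≡1 zero    = refl
  ⌈1/2^k⌉≡1 (suc k) = ⌈1/2^k⌉≡1 k

  module Walks {n : ℕ} (G : Graph n) (isG : IsGraph G) where
    open IsGraph isG
    open import Data.List.Membership.DecPropositional (_≟_ {n}) using (_∈?_)

    vertices : ∀ {a b} → Walk G a b → List (Fin n)
    vertices {a} here       = a ∷ []
    vertices {a} (step _ w) = a ∷ vertices w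

    start∈ : ∀ {a b} (w : Walk G a b) → a ∈ vertices w
    start∈ here       = hd refl
    start∈ (step _ _) = hd refl

    end∈ : ∀ {a b} (w : Walk G a b) → b ∈ vertices w
    end∈ here       = hd refl
    end∈ (step _ w) = tl (end∈ w)

    infixr 5 _++ʷ_
    _++ʷ_ : ∀ {a b c} → Walk G a b → Walk G b c → Walk G a c
    here     ++ʷ w = w
    step e v ++ʷ w = step e (v ++ʷ w)

    ∈-++ʷ⁻ : ∀ {a b c z} (v : Walk G a b) (w : Walk G b c) →
             z ∈ vertices (v ++ʷ w) → z ∈ vertices v ⊎ z ∈ vertices w
    ∈-++ʷ⁻ here       w m        = inj₂ m
    ∈-++ʷ⁻ (step _ v) w (hd refl) = inj₁ (hd refl)
    ∈-++ʷ⁻ (step _ v) w (tl m)   = Data.Sum.map₁ tl (∈-++ʷ⁻ v w m)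

    ∈-++ʷ⁺ˡ : ∀ {a b c z} (v : Walk G a b) {w : Walk G b c} → z ∈ vertices v → z ∈ vertices (v ++ʷ w)
    ∈-++ʷ⁺ˡ here       {w} (hd refl) = start∈ w
    ∈-++ʷ⁺ˡ (step _ v)     (hd refl) = hd refl
    ∈-++ʷ⁺ˡ (step _ v)     (tl m)    = tl (∈-++ʷ⁺ˡ v m)

    ∈-++ʷ⁺ʳ : ∀ {a b c z} (v : Walk G a b) {w : Walk G b c} → z ∈ vertices w → z ∈ vertices (v ++ʷ w)
    ∈-++ʷ⁺ʳ here       m = m
    ∈-++ʷ⁺ʳ (step _ v) m = tl (∈-++ʷ⁺ʳ v m)

    reverse : ∀ {a b} → Walk G a b → Walk G b a
    reverse here       = here
    reverse (step e w) = reverse w ++ʷ step (symm _ _ e) here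

    ∈-reverse⁻ : ∀ {a b z} (w : Walk G a b) → z ∈ vertices (reverse w) → z ∈ vertices w
    ∈-reverse⁻ here m = m
    ∈-reverse⁻ (step e w) m with ∈-++ʷ⁻ (reverse w) _ m
    ... | inj₁ m′        = tl (∈-reverse⁻ w m′)
    ... | inj₂ (hd refl) = tl (start∈ w)
    ... | inj₂ (tl (hd refl)) = hd refl

    ∈-reverse⁺ : ∀ {a b z} (w : Walk G a b) → z ∈ vertices w → z ∈ vertices (reverse w)
    ∈-reverse⁺ here       m        = m
    ∈-reverse⁺ (step e w) (hd refl) = ∈-++ʷ⁺ʳ (reverse w) (tl (hd refl))
    ∈-reverse⁺ (step e w) (tl m)   = ∈-++ʷ⁺ˡ (reverse w) (∈-reverse⁺ w m)

    prefix : ∀ {a b z} (w : Walk G a b) → z ∈ vertices w →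
             Σ (Walk G a z) λ v → vertices v ⊆ vertices w
    prefix here       (hd refl) = here , id
    prefix (step e w) (hd refl) = here , λ { (hd refl) → hd refl }
    prefix (step e w) (tl m) with prefix w m
    ... | v , v⊆w = step e v , λ { (hd refl) → hd refl ; (tl m′) → tl (v⊆w m′) }

    lastExit : ∀ {a b z} (w : Walk G a b) → z ∈ vertices w → z ≢ b →
               ∃ λ y → Adj G z y × Σ (Walk G y b) λ v → z ∉ vertices v × vertices v ⊆ vertices w
    lastExit here (hd refl) z≢b = ⊥-elim (z≢b refl)
    lastExit {z = z} (step e w) m z≢b with z ∈? vertices w
    ... | yes m′ = let y , zy , v , z∉v , v⊆w = lastExit w m′ z≢b in y , zy , v , z∉v , tl ∘ v⊆w
    lastExit (step e w) (hd refl) z≢b | no z∉w = _ , e , w , z∉w , tl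
    lastExit (step e w) (tl m)    z≢b | no z∉w = ⊥-elim (z∉w m)

    firstEntry : ∀ {a b z} (w : Walk G a b) → z ∈ vertices w → z ≢ a →
                 ∃ λ y → Adj G y z × Σ (Walk G a y) λ v → z ∉ vertices v × vertices v ⊆ vertices w
    firstEntry w m z≢a with lastExit (reverse w) (∈-reverse⁺ w m) z≢a
    ... | y , zy , v , z∉v , v⊆w =
      y , symm _ _ zy , reverse v , z∉v ∘ ∈-reverse⁻ v , ∈-reverse⁻ w ∘ v⊆w ∘ ∈-reverse⁻ v

    loopErase : ∀ {a b} (w : Walk G a b) → Σ (Walk G a b) λ v → Unique (vertices v) × vertices v ⊆ vertices w
    loopErase here = here , [] ∷ [] , id
    loopErase {a} {b} (step e w) with loopErase w
    ... | v , uv , v⊆w with a ∈? vertices v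
    ...   | no a∉v = step e v , All.tabulate (λ m a≡ → a∉v (subst (_∈ vertices v) (sym a≡) m)) ∷ uv ,
                     λ { (hd refl) → hd refl ; (tl m) → tl (v⊆w m) }
    ...   | yes a∈v = suffix v a∈v uv id
      where
      suffix : ∀ {c} (u : Walk G c b) → a ∈ vertices u → Unique (vertices u) → vertices u ⊆ vertices v →
               Σ (Walk G a b) λ u′ → Unique (vertices u′) × vertices u′ ⊆ vertices (step e w)
      suffix here       (hd refl) uu u⊆v = here , uu , tl ∘ v⊆w ∘ u⊆v
      suffix (step f u) (hd refl) uu u⊆v = step f u , uu , tl ∘ v⊆w ∘ u⊆v
      suffix (step _ u) (tl m) (_ ∷ uu) u⊆v = suffix u m uu (u⊆v ∘ tl)

  module Tree {n : ℕ} (T : Graph n) (isT : IsTree T) (spanning : verts T ≡ SS.⊤) where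
    open IsTree isT public
    open IsGraph isGraph public
    open Walks T isGraph public
    open import Data.List.Membership.DecPropositional (_≟_ {n}) using (_∈?_)

    A : Fin n → Fin n → Set
    A = Adj T

    ∈T : ∀ v → v SS.∈ verts T
    ∈T v = subst (v SS.∈_) (sym spanning) SSP.∈⊤

    walk : ∀ u v → Walk T u v
    walk u v = connected u v (∈T u) (∈T v)

    adj⇒≢ : ∀ {a b} → A a b → a ≢ b
    adj⇒≢ {a} ab refl = irrefl a ab

    no-bypass : ∀ {a b v} → a ≢ b → A a v → A b v → (w : Walk T a b) → v ∉ vertices w → ⊥
    no-bypass {a} {b} {v} a≢b av bv w v∉w with loopErase w
    ... | u , uu , u⊆w = acyclic (v ∷ vertices u) (length≥3 a≢b u , v∉u ∷ uu , closing (symm _ _ av) u)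
      where
      v∉u : All (v ≢_) (vertices u)
      v∉u = All.tabulate λ m v≡ → v∉w (u⊆w (subst (_∈ vertices u) (sym v≡) m))
      length≥3 : ∀ {c} → c ≢ b → (u : Walk T c b) → 3 ≤ suc (length (vertices u))
      length≥3 c≢b here                = ⊥-elim (c≢b refl)
      length≥3 c≢b (step _ here)       = s≤s (s≤s (s≤s z≤n))
      length≥3 c≢b (step _ (step _ _)) = s≤s (s≤s (s≤s z≤n))
      path : ∀ {c} (u : Walk T c b) → Linked A (vertices u ++ v ∷ [])
      path here                = bv ∷ [-]
      path (step e here)       = e ∷ bv ∷ [-]
      path (step e (step f u)) = e ∷ path (step f u)
      closing : ∀ {c} → A v c → (u : Walk T c b) → Linked A (v ∷ vertices u ++ v ∷ [])
      closing vc here       = vc ∷ bv ∷ [-]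
      closing vc (step e u) = vc ∷ path (step e u)

    Along : (Fin n → Set) → ∀ {a b} → Walk T a b → Set
    Along P w = ∀ {z} → z ∈ vertices w → P z

    along-∉ : ∀ {z a b} {w : Walk T a b} → z ∉ vertices w → Along (_≢ z) w
    along-∉ z∉w m refl = z∉w m

    Reach : (Fin n → Set) → Fin n → Fin n → Set
    Reach P a b = Σ (Walk T a b) (Along P)

    module _ {P : Fin n → Set} where
      reach-here : ∀ {a} → P a → Reach P a a
      reach-here pa = here , λ { (hd refl) → pa }

      reach-start : ∀ {a b} → Reach P a b → P a
      reach-start (w , ok) = ok (start∈ w)

      reach-end : ∀ {a b} → Reach P a b → P b
      reach-end (w , ok) = ok (end∈ w)

      reach-++ : ∀ {a b c} → Reach P a b → Reach P b c → Reach P a c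
      reach-++ (v , okv) (w , okw) = v ++ʷ w , [ okv , okw ]′ ∘ ∈-++ʷ⁻ v w

      reach-∷ʳ : ∀ {a b c} → Reach P a b → A b c → P c → Reach P a c
      reach-∷ʳ r bc pc = reach-++ r (step bc here , λ { (hd refl) → reach-end r ; (tl (hd refl)) → pc })

      reach-reverse : ∀ {a b} → Reach P a b → Reach P b a
      reach-reverse (w , ok) = reverse w , ok ∘ ∈-reverse⁻ w

      reach-prefix : ∀ {a b z} (r : Reach P a b) → z ∈ vertices (proj₁ r) → Reach P a z
      reach-prefix (w , ok) m = let v , v⊆w = prefix w m in v , ok ∘ v⊆w

    reach-prefixes : ∀ {P a b} (r : Reach P a b) → Reach (Reach P a) a b
    reach-prefixes r = proj₁ r , reach-prefix r

    reach-map : ∀ {P Q : Fin n → Set} → (∀ {z} → P z → Q z) → ∀ {a b} → Reach P a b → Reach Q a b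
    reach-map f (w , ok) = w , f ∘ ok

    degree≡1⇒unique : ∀ (H : Graph n) v {j k} → degree H v ≡ 1 → Adj H v j → Adj H v k → j ≡ k
    degree≡1⇒unique H v = ∑⟦⟧≡1⇒unique (Adj? H v)

    unique⇒degree≡1 : ∀ (H : Graph n) v {j} → Adj H v j → (∀ {k} → Adj H v k → k ≡ j) → degree H v ≡ 1
    unique⇒degree≡1 H v = ∑⟦⟧≡1 (Adj? H v)

    module _ {S : Fin n → Set} (S? : ∀ v → Dec (S v)) where
      private
        T[S] : Graph n
        T[S] = induced T S?

      induced-walk : ∀ {a b} → Reach S a b → Walk T[S] a b
      induced-walk = uncurry go
        where go : ∀ {a b} (w : Walk T a b) → Along S w → Walk T[S] a b
              go here       _  = here
              go (step e w) ok = step (induced-adj⁺ T S? e (ok (hd refl)) (ok (tl (start∈ w)))) (go w (ok ∘ tl))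

      induced-isWSubtree : (W : SS.Subset n) {root : Fin n} → S root →
        (∀ {v} → S v → Walk T[S] root v) →
        (∀ {v} → v SS.∈ W → S v → ∃ λ s → A v s × S s × ∀ {s′} → A v s′ → S s′ → s′ ≡ s) →
        (∀ {u z} → S u → ¬ u SS.∈ W → A u z → S z) →
        IsWSubtree T W T[S]
      induced-isWSubtree W {root} s-root reach leaf closed =
        (isTree , (λ {v} _ → ∈T v) , λ u v uv → proj₁ (induced-adj⁻ T S? uv)) , leaves , maximal
        where
        module T[S] = Walks T[S] (isGraph-induced T S? isGraph)
        isTree : IsTree T[S]
        isTree = record
          { isGraph   = isGraph-induced T S? isGraph
          ; nonempty  = root , induced-verts⁺ T S? s-root
          ; connected = λ u v mu mv →
              T[S].reverse (reach (induced-verts⁻ T S? mu)) T[S].++ʷ reach (induced-verts⁻ T S? mv)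
          ; acyclic   = λ vs (len , u , cyc) → acyclic vs (len , u , Linked.map (proj₁ ∘ induced-adj⁻ T S?) cyc)
          }
        leaves : WOnlyLeaves W T[S]
        leaves v v∈W mv with leaf v∈W (induced-verts⁻ T S? mv)
        ... | s , vs , ss , only = unique⇒degree≡1 T[S] v (induced-adj⁺ T S? vs (induced-verts⁻ T S? mv) ss)
                                    λ vk → let vk , _ , sk = induced-adj⁻ T S? vk in only vk sk
        maximal : ∀ H → IsSubtree T H → WOnlyLeaves W H → T[S] ≤G H → H ≤G T[S]
        maximal H (treeH , _ , H⊆T) leavesH (verts⊆ , adj⊆) = verts⊆S , λ u v uv →
            let mu , mv = H.endsIn u v uv in
            induced-adj⁺ T S? (H⊆T u v uv) (induced-verts⁻ T S? (verts⊆S mu)) (induced-verts⁻ T S? (verts⊆S mv))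
          where
          module H = IsGraph (IsTree.isGraph treeH)
          stays : ∀ {u v} → Walk H u v → S u → S v
          stays here su = su
          stays {u} (step {w = z} uz w) su with u SSP.∈? W
          ... | no u∉W = stays w (closed su u∉W (H⊆T u z uz))
          ... | yes u∈W with leaf u∈W su
          ...   | s , us , ss , _ = stays w (subst S (sym z≡s) ss)
            where
            z≡s : z ≡ s
            z≡s = degree≡1⇒unique H u (leavesH u u∈W (proj₁ (H.endsIn u z uz))) uz
                    (adj⊆ u s (induced-adj⁺ T S? us su ss))
          verts⊆S : verts H SS.⊆ verts T[S]
          verts⊆S {v} mv = induced-verts⁺ T S?
            (stays (IsTree.connected treeH root v (verts⊆ (induced-verts⁺ T S? s-root)) mv) s-root)

    -- Side x y is the component of T - x containing y; adding x gives the branch of T at x through the edge xy.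
    Side : Fin n → Fin n → Fin n → Set
    Side x = Reach (_≢ x)

    Branch : Fin n → Fin n → Fin n → Set
    Branch x y v = v ≡ x ⊎ Side x y v

    side-self : ∀ {x y} → A x y → Side x y y
    side-self xy = reach-here (adj⇒≢ xy ∘ sym)

    side-unique : ∀ {x y y′ v} → A x y → A x y′ → Side x y v → Side x y′ v → y ≡ y′
    side-unique {y = y} {y′} xy xy′ s s′ with y ≟ y′
    ... | yes y≡y′ = y≡y′
    ... | no y≢y′ = let w , ok = reach-++ s (reach-reverse s′) in
                    ⊥-elim (no-bypass y≢y′ (symm _ _ xy) (symm _ _ xy′) w (λ m → ok m refl))

    side-exists : ∀ {x v} → v ≢ x → ∃ λ y → A x y × Side x y v
    side-exists {x} {v} v≢x with lastExit (walk x v) (start∈ (walk x v)) (v≢x ∘ sym)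
    ... | y , xy , w , x∉w , _ = y , xy , w , along-∉ x∉w

    branch-unique : ∀ {x y y′ v} → v ≢ x → A x y → A x y′ → Branch x y v → Branch x y′ v → y ≡ y′
    branch-unique v≢x xy xy′ (inj₂ s) (inj₂ s′) = side-unique xy xy′ s s′
    branch-unique v≢x xy xy′ (inj₁ v≡x) _ = ⊥-elim (v≢x v≡x)
    branch-unique v≢x xy xy′ _ (inj₁ v≡x) = ⊥-elim (v≢x v≡x)

    branch-neighbour : ∀ {x y p} → A x p → Branch x y p → A x y → y ≡ p
    branch-neighbour xp b xy = branch-unique (adj⇒≢ xp ∘ sym) xy xp b (inj₂ (side-self xp))

    side-step : ∀ {x y u z} → Side x y u → A u z → Branch x y z
    side-step {x} {z = z} yu uz with z ≟ x
    ... | yes z≡x = inj₁ z≡x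
    ... | no z≢x  = inj₂ (reach-∷ʳ yu uz z≢x)

    -- y and v are on the same side of x iff x's neighbours towards them coincide
    side? : ∀ x y v → Dec (Side x y v)
    side? x y v with y ≟ x | v ≟ x
    ... | yes refl | _        = no λ s → reach-start s refl
    ... | no _     | yes refl = no λ s → reach-end s refl
    ... | no y≢x   | no v≢x with side-exists y≢x | side-exists v≢x
    ...   | t , xt , ty | t′ , xt′ , t′v with t ≟ t′
    ...     | yes refl = yes (reach-++ (reach-reverse ty) t′v)
    ...     | no t≢t′  = no λ yv → t≢t′ (side-unique xt xt′ (reach-++ ty yv) t′v)

    branch? : ∀ x y v → Dec (Branch x y v)
    branch? x y v = (v ≟ x) ⊎-dec side? x y v

    -- Edge counts of branches

    Child : Fin n → Fin n → Fin n → Set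
    Child q x y = A x y × y ≢ q

    child? : ∀ q x y → Dec (Child q x y)
    child? q x y = Adj? T x y ×-dec ¬? (y ≟ q)

    branchGraph : Fin n → Fin n → Graph n
    branchGraph x y = induced T (branch? x y)

    β : Fin n → Fin n → ℕ
    β x y = edgeCount (branchGraph x y)

    childWeight : Fin n → Fin n → Fin n → ℕ
    childWeight q x y = if does (child? q x y) then β x y else 0

    -- the edges separated from q by x; with q = x, all edges of T
    below : Fin n → Fin n → ℕ
    below q x = ∑ (childWeight q x)

    -- ⟦ edge? S? i j ⟧ is definitionally the (i , j) term of edgeCount (induced T S?)
    Edge : (Fin n → Set) → Fin n → Fin n → Set
    Edge S i j = i <ᶠ j × A i j × S i × S j

    edge? : ∀ {S : Fin n → Set} → (∀ v → Dec (S v)) → ∀ i j → Dec (Edge S i j)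
    edge? S? i j = i <ᶠ? j ×-dec Adj? T i j ×-dec S? i ×-dec S? j

    BranchEdge : Fin n → Fin n → Fin n → Fin n → Set
    BranchEdge x y i j = Branch x y i × Branch x y j

    branch-edge-unique : ∀ {x y y′ i j} → A x y → A x y′ → A i j → BranchEdge x y i j → BranchEdge x y′ i j → y ≡ y′
    branch-edge-unique {x} {i = i} xy xy′ ij (bi , bj) (bi′ , bj′) with i ≟ x
    ... | no i≢x   = branch-unique i≢x xy xy′ bi bi′
    ... | yes refl = branch-unique (adj⇒≢ ij ∘ sym) xy xy′ bj bj′

    ∑∑-edges-split : ∀ {E F : Fin n → Fin n → Set} (E? : ∀ i j → Dec (E i j)) (F? : ∀ i j → Dec (F i j)) q x →
      (∀ {i j} → E i j → ¬ F i j → ∃ λ y → Child q x y × Edge (Branch x y) i j) →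
      (∀ {i j} → F i j → E i j) →
      (∀ {i j y} → Child q x y → Edge (Branch x y) i j → E i j) →
      (∀ {i j y} → F i j → Child q x y → ¬ Edge (Branch x y) i j) →
      (∑ λ i → ∑ λ j → ⟦ E? i j ⟧) ≡ (∑ λ i → ∑ λ j → ⟦ F? i j ⟧) + below q x
    ∑∑-edges-split E? F? q x E⇒ F⇒E C⇒E F∩C =
      trans (∑∑-split _ _ (λ y i j → ⟦ C? y i j ⟧) pointwise) (cong (_ +_) (∑-cong per-child))
      where
      C? : ∀ y i j → Dec (Child q x y × Edge (Branch x y) i j)
      C? y i j = child? q x y ×-dec edge? (branch? x y) i j
      pointwise : ∀ i j → ⟦ E? i j ⟧ ≡ ⟦ F? i j ⟧ + ∑ λ y → ⟦ C? y i j ⟧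
      pointwise i j = ⟦⟧-partition (E? i j) (F? i j) (λ y → C? y i j) E⇒ F⇒E (λ (ch , e) → C⇒E ch e)
                        (λ f (ch , e) → F∩C f ch e) (λ (ch , _ , ij , bi , bj) (ch′ , _ , _ , bi′ , bj′) →
                           branch-edge-unique (proj₁ ch) (proj₁ ch′) ij (bi , bj) (bi′ , bj′))
      per-child : ∀ y → (∑ λ i → ∑ λ j → ⟦ C? y i j ⟧) ≡ (if does (child? q x y) then β x y else 0)
      per-child y = trans (∑-cong λ i → ∑-cong λ j → ⟦⟧-×-dec (child? q x y) (edge? (branch? x y) i j))
                          (∑∑-if (does (child? q x y)) (λ i j → ⟦ edge? (branch? x y) i j ⟧))

    edge-of-pair : ∀ {S : Fin n → Set} {a b} → a <ᶠ b → (∀ {v} → S v → v ≡ a ⊎ v ≡ b) →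
                   ∀ {i j} → Edge S i j → i ≡ a × j ≡ b
    edge-of-pair a<b pair (i<j , ij , si , sj) with pair si | pair sj
    ... | inj₁ refl | inj₂ refl = refl , refl
    ... | inj₁ refl | inj₁ refl = ⊥-elim (adj⇒≢ ij refl)
    ... | inj₂ refl | inj₂ refl = ⊥-elim (adj⇒≢ ij refl)
    ... | inj₂ refl | inj₁ refl = ⊥-elim (<ᶠ-asym a<b i<j)

    edgeCount-pair : ∀ {S : Fin n → Set} (S? : ∀ v → Dec (S v)) {x y} → A x y → S x → S y →
                     (∀ {v} → S v → v ≡ x ⊎ v ≡ y) → edgeCount (induced T S?) ≡ 1
    edgeCount-pair S? {x} {y} xy sx sy pair with <ᶠ-cmp x y
    ... | tri< x<y _ _ = ∑∑⟦⟧≡1 (edge? S?) (x<y , xy , sx , sy) (edge-of-pair x<y pair)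
    ... | tri≈ _ x≡y _ = ⊥-elim (adj⇒≢ xy x≡y)
    ... | tri> _ _ y<x = ∑∑⟦⟧≡1 (edge? S?) (y<x , symm _ _ xy , sy , sx) (edge-of-pair y<x (Data.Sum.swap ∘ pair))

    branch-isWSubtree : ∀ {x y} (W : SS.Subset n) → A x y → x SS.∈ W → (∀ {v} → v SS.∈ W → ¬ Side x y v) →
                        IsWSubtree T W (branchGraph x y)
    branch-isWSubtree {x} {y} W xy x∈W W∩side = induced-isWSubtree (branch? x y) W (inj₁ refl) reach leaf closed
      where
      reach : ∀ {v} → Branch x y v → Walk (branchGraph x y) x v
      reach (inj₁ refl) = here
      reach (inj₂ r)    = step (induced-adj⁺ T (branch? x y) xy (inj₁ refl) (inj₂ (side-self xy)))
                               (induced-walk (branch? x y) (reach-map inj₂ (reach-prefixes r)))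
      leaf : ∀ {v} → v SS.∈ W → Branch x y v → ∃ λ s → A v s × Branch x y s × ∀ {s′} → A v s′ → Branch x y s′ → s′ ≡ s
      leaf v∈W (inj₂ r)    = ⊥-elim (W∩side v∈W r)
      leaf v∈W (inj₁ refl) = y , xy , inj₂ (side-self xy) , only
        where only : ∀ {s′} → A x s′ → Branch x y s′ → s′ ≡ y
              only xs′ (inj₁ refl) = ⊥-elim (adj⇒≢ xs′ refl)
              only xs′ (inj₂ r)    = side-unique xs′ xy (side-self xs′) r
      closed : ∀ {u z} → Branch x y u → ¬ u SS.∈ W → A u z → Branch x y z
      closed (inj₁ refl) u∉W _ = ⊥-elim (u∉W x∈W)
      closed (inj₂ r)    _   uz = side-step r uz

    -- The trunk of a branch above a vertex

    Avoiding : Fin n → Fin n → Fin n → Set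
    Avoiding p x u = u ≢ p × u ≢ x

    -- x lies in the branch at p towards c, and q is the neighbour of x towards p
    record Inside (p c q x : Fin n) : Set where
      field
        pc  : A p c
        x≢p : x ≢ p
        cx  : Side p c x
        xq  : A x q
        qp  : Branch x q p

    Trunk : Fin n → Fin n → Fin n → Fin n → Set
    Trunk p c x v = v ≡ p ⊎ v ≡ x ⊎ Reach (Avoiding p x) c v

    module _ {p c q x} (I : Inside p c q x) where
      open Inside I

      -- in a tree, a walk that leaves x and returns to it through the same neighbour can be shortcut
      avoid-x : ∀ {z} → Reach (_≢ p) c z → Side x q z → Reach (Avoiding p x) c z
      avoid-x {z} (w , w≢p) qz with x ∈? vertices w
      ... | no x∉w = w , λ m → w≢p m , along-∉ x∉w m
      ... | yes x∈w with lastExit w x∈w (reach-end qz ∘ sym)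
      ...   | y , xy , w₂ , x∉w₂ , w₂⊆w with side-unique xy xq (w₂ , along-∉ x∉w₂) qz
      ...     | refl with c ≟ x
      ...       | yes refl = ⊥-elim (w≢p (w₂⊆w (start∈ w₂)) (branch-neighbour (symm _ _ pc) qp xq))
      ...       | no c≢x with firstEntry w x∈w (c≢x ∘ sym)
      ...         | y′ , y′x , w₁ , x∉w₁ , w₁⊆w =
        reach-++ (w₁ , λ m → w≢p (w₁⊆w m) , along-∉ x∉w₁ m)
                 (subst (λ t → Reach (Avoiding p x) t z) (sym y′≡q) (w₂ , λ m → w≢p (w₂⊆w m) , along-∉ x∉w₂ m))
        where
        y′p : Side x y′ p
        y′p = reach-∷ʳ (reach-reverse (w₁ , along-∉ x∉w₁)) (symm _ _ pc) (x≢p ∘ sym)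
        y′≡q : y′ ≡ q
        y′≡q = branch-unique (x≢p ∘ sym) (symm _ _ y′x) xq (inj₂ y′p) qp

      side-c : c ≢ x → Side x q c
      side-c c≢x with qp
      ... | inj₁ p≡x = ⊥-elim (x≢p (sym p≡x))
      ... | inj₂ qp′ = reach-∷ʳ qp′ pc c≢x

      trunk-sides : ∀ {v} → Reach (Avoiding p x) c v → Side p c v × Side x q v
      trunk-sides r = reach-map proj₁ r , reach-++ (side-c (proj₂ (reach-start r))) (reach-map proj₂ r)

      trunk? : ∀ v → Dec (Trunk p c x v)
      trunk? v = (v ≟ p) ⊎-dec (v ≟ x) ⊎-dec
                 map′ (λ (cv , qv) → avoid-x cv qv) trunk-sides (side? p c v ×-dec side? x q v)

      c∈trunk : Trunk p c x c
      c∈trunk with c ≟ x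
      ... | yes c≡x = inj₂ (inj₁ c≡x)
      ... | no c≢x  = inj₂ (inj₂ (reach-here (adj⇒≢ pc ∘ sym , c≢x)))

      inner⇒trunk : ∀ {v} → Reach (Avoiding p x) c v → Reach (Trunk p c x) c v
      inner⇒trunk r = reach-map (inj₂ ∘ inj₂) (reach-prefixes r)

      q∈trunk : Trunk p c x q
      q∈trunk with q ≟ p
      ... | yes q≡p = inj₁ q≡p
      ... | no q≢p  = inj₂ (inj₂ (avoid-x (reach-∷ʳ cx xq q≢p) (side-self xq)))

      trunkGraph : Graph n
      trunkGraph = induced T trunk?

      trunk-isWSubtree : (W : SS.Subset n) → p SS.∈ W → x SS.∈ W →
                         (∀ {v} → v SS.∈ W → ¬ Reach (Avoiding p x) c v) → IsWSubtree T W trunkGraph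
      trunk-isWSubtree W p∈W x∈W W∩inner = induced-isWSubtree trunk? W (inj₁ refl) reach leaf closed
        where
        via-c : ∀ {v} → Reach (Trunk p c x) c v → Walk trunkGraph p v
        via-c r = step (induced-adj⁺ T trunk? pc (inj₁ refl) c∈trunk) (induced-walk trunk? r)
        reach : ∀ {v} → Trunk p c x v → Walk trunkGraph p v
        reach (inj₁ refl)        = here
        reach (inj₂ (inj₂ r))    = via-c (inner⇒trunk r)
        reach (inj₂ (inj₁ refl)) with q ≟ p
        ... | yes refl = step (induced-adj⁺ T trunk? (symm _ _ xq) (inj₁ refl) (inj₂ (inj₁ refl))) here
        ... | no q≢p   = via-c (reach-∷ʳ (inner⇒trunk (avoid-x (reach-∷ʳ cx xq q≢p) (side-self xq)))
                                         (symm _ _ xq) (inj₂ (inj₁ refl)))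
        leaf : ∀ {v} → v SS.∈ W → Trunk p c x v →
               ∃ λ s → A v s × Trunk p c x s × ∀ {s′} → A v s′ → Trunk p c x s′ → s′ ≡ s
        leaf v∈W (inj₂ (inj₂ r))    = ⊥-elim (W∩inner v∈W r)
        leaf v∈W (inj₁ refl)        = c , pc , c∈trunk , only
          where only : ∀ {s′} → A p s′ → Trunk p c x s′ → s′ ≡ c
                only ps′ (inj₁ refl)        = ⊥-elim (adj⇒≢ ps′ refl)
                only ps′ (inj₂ (inj₁ refl)) = side-unique ps′ pc (side-self ps′) cx
                only ps′ (inj₂ (inj₂ r))    = side-unique ps′ pc (side-self ps′) (proj₁ (trunk-sides r))
        leaf v∈W (inj₂ (inj₁ refl)) = q , xq , q∈trunk , only
          where only : ∀ {s′} → A x s′ → Trunk p c x s′ → s′ ≡ q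
                only xs′ (inj₁ refl)        = sym (branch-neighbour xs′ qp xq)
                only xs′ (inj₂ (inj₁ refl)) = ⊥-elim (adj⇒≢ xs′ refl)
                only xs′ (inj₂ (inj₂ r))    = side-unique xs′ xq (side-self xs′) (proj₂ (trunk-sides r))
        closed : ∀ {u z} → Trunk p c x u → ¬ u SS.∈ W → A u z → Trunk p c x z
        closed (inj₁ refl)        u∉W _ = ⊥-elim (u∉W p∈W)
        closed (inj₂ (inj₁ refl)) u∉W _ = ⊥-elim (u∉W x∈W)
        closed {z = z} (inj₂ (inj₂ r)) _ uz with z ≟ p | z ≟ x
        ... | yes z≡p | _       = inj₁ z≡p
        ... | no _    | yes z≡x = inj₂ (inj₁ z≡x)
        ... | no z≢p  | no z≢x  = inj₂ (inj₂ (reach-∷ʳ r uz (z≢p , z≢x)))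

      trunk⊆branch : ∀ {v} → Trunk p c x v → Branch p c v
      trunk⊆branch (inj₁ refl)        = inj₁ refl
      trunk⊆branch (inj₂ (inj₁ refl)) = inj₂ cx
      trunk⊆branch (inj₂ (inj₂ r))    = inj₂ (proj₁ (trunk-sides r))

      p∉child-side : ∀ {y} → Child q x y → ¬ Side x y p
      p∉child-side (xy , y≢q) yp = y≢q (branch-unique (x≢p ∘ sym) xy xq (inj₂ yp) qp)

      child-branch⊆branch : ∀ {y v} → Child q x y → Branch x y v → Branch p c v
      child-branch⊆branch _  (inj₁ refl) = inj₂ cx
      child-branch⊆branch ch (inj₂ r) with p ∈? vertices (proj₁ r)
      ... | yes p∈r = ⊥-elim (p∉child-side ch (reach-prefix r p∈r))
      ... | no p∉r  =
        inj₂ (reach-++ (reach-∷ʳ cx (proj₁ ch) (along-∉ p∉r (start∈ (proj₁ r)))) (proj₁ r , along-∉ p∉r))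

      trunk∩child-branch : ∀ {y v} → Child q x y → Trunk p c x v → Branch x y v → v ≡ x
      trunk∩child-branch _  _                 (inj₁ v≡x) = v≡x
      trunk∩child-branch ch (inj₁ refl)       (inj₂ r)   = ⊥-elim (p∉child-side ch r)
      trunk∩child-branch _  (inj₂ (inj₁ v≡x)) (inj₂ _)   = v≡x
      trunk∩child-branch ch (inj₂ (inj₂ r′))  (inj₂ r)   = ⊥-elim (p∉child-side ch
        (reach-∷ʳ (reach-++ r (reach-reverse (reach-map proj₂ r′))) (symm _ _ pc) (x≢p ∘ sym)))

      branch∖trunk⇒child : ∀ {v} → Branch p c v → ¬ Trunk p c x v → ∃ λ y → Child q x y × Side x y v
      branch∖trunk⇒child (inj₁ refl) v∉ = ⊥-elim (v∉ (inj₁ refl))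
      branch∖trunk⇒child {v} (inj₂ r) v∉ with v ≟ x
      ... | yes refl = ⊥-elim (v∉ (inj₂ (inj₁ refl)))
      ... | no v≢x with side-exists v≢x
      ...   | y , xy , yv with y ≟ q
      ...     | yes refl = ⊥-elim (v∉ (inj₂ (inj₂ (avoid-x r yv))))
      ...     | no y≢q   = y , (xy , y≢q) , yv

      β≡trunk+below : β p c ≡ edgeCount trunkGraph + below q x
      β≡trunk+below = ∑∑-edges-split (edge? (branch? p c)) (edge? trunk?) q x split
        (λ (i<j , ij , ti , tj) → i<j , ij , trunk⊆branch ti , trunk⊆branch tj)
        (λ ch (i<j , ij , bi , bj) → i<j , ij , child-branch⊆branch ch bi , child-branch⊆branch ch bj)
        (λ (_ , ij , ti , tj) ch (_ , _ , bi , bj) →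
           adj⇒≢ ij (trans (trunk∩child-branch ch ti bi) (sym (trunk∩child-branch ch tj bj))))
        where
        split : ∀ {i j} → Edge (Branch p c) i j → ¬ Edge (Trunk p c x) i j →
                ∃ λ y → Child q x y × Edge (Branch x y) i j
        split {i} {j} (i<j , ij , bi , bj) ¬t with trunk? i
        ... | no i∉ = let y , ch , yi = branch∖trunk⇒child bi i∉ in
                      y , ch , i<j , ij , inj₂ yi , side-step yi ij
        ... | yes ti = let y , ch , yj = branch∖trunk⇒child bj (λ tj → ¬t (i<j , ij , ti , tj)) in
                       y , ch , i<j , ij , side-step yj (symm _ _ ij) , inj₂ yj

    inside-root : ∀ {p c} → A p c → Inside p c p c
    inside-root pc = record
      { pc = pc ; x≢p = adj⇒≢ pc ∘ sym ; cx = side-self pc ; xq = symm _ _ pc ; qp = inj₂ (side-self (symm _ _ pc)) }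

    inside-child : ∀ {p c q x y} → Inside p c q x → Child q x y → Inside p c x y
    inside-child {p} {c} {q} {x} {y} I ch@(xy , y≢q) = record
      { pc = pc ; x≢p = reach-end cy ; cx = cy ; xq = symm _ _ xy ; qp = inj₂ yp }
      where
      open Inside I
      cy : Side p c y
      cy with child-branch⊆branch I ch (inj₂ (side-self xy))
      ... | inj₁ refl = ⊥-elim (p∉child-side I ch (side-self xy))
      ... | inj₂ cy   = cy
      yp : Side y x p
      yp with qp
      ... | inj₁ p≡x = ⊥-elim (x≢p (sym p≡x))
      ... | inj₂ (w , w≢x) with y ∈? vertices w
      ...   | yes y∈w = ⊥-elim (y≢q (side-unique xy xq (side-self xy) (reach-prefix (w , w≢x) y∈w)))
      ...   | no y∉w  = step xq w , λ { (hd refl) → adj⇒≢ xy ; (tl m) → along-∉ y∉w m }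

    β≡1+below : ∀ {x y} → A x y → β x y ≡ 1 + below x y
    β≡1+below {x} {y} xy = trans (β≡trunk+below I)
      (cong (_+ below x y) (edgeCount-pair (trunk? I) xy (inj₁ refl) (inj₂ (inj₁ refl)) pair))
      where
      I : Inside x y x y
      I = inside-root xy
      pair : ∀ {v} → Trunk x y y v → v ≡ x ⊎ v ≡ y
      pair (inj₁ v≡x)        = inj₁ v≡x
      pair (inj₂ (inj₁ v≡y)) = inj₂ v≡y
      pair (inj₂ (inj₂ r))   = ⊥-elim (proj₂ (reach-start r) refl)

    edgeCount≡below : ∀ r → edgeCount T ≡ below r r
    edgeCount≡below r = trans
      (∑∑-edges-split (λ i j → i <ᶠ? j ×-dec Adj? T i j) (λ _ _ → ⊥-dec) r r
                      split (λ ()) (λ _ (i<j , ij , _) → i<j , ij) (λ ()))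
      (cong (_+ below r r) (trans (∑-cong {n} (λ _ → ∑-zero {n})) (∑-zero {n})))
      where
      split : ∀ {i j} → i <ᶠ j × A i j → _ → ∃ λ y → Child r r y × Edge (Branch r y) i j
      split {i} {j} (i<j , ij) _ with i ≟ r
      ... | yes refl = j , (ij , adj⇒≢ ij ∘ sym) , i<j , ij , inj₁ refl , inj₂ (side-self ij)
      ... | no i≢r   = let y , ry , yi = side-exists i≢r in
                       y , (ry , adj⇒≢ ry ∘ sym) , i<j , ij , inj₂ yi , side-step yi ij

    -- Selecting W-subtrees

    childWeight-β : ∀ {q x y} → Child q x y → childWeight q x y ≡ β x y
    childWeight-β {q} {x} {y} ch = cong (λ b → if b then β x y else 0) (dec-true (child? q x y) ch)

    childWeight-0 : ∀ {q x y} → ¬ Child q x y → childWeight q x y ≡ 0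
    childWeight-0 {q} {x} {y} ¬ch = cong (λ b → if b then β x y else 0) (dec-false (child? q x y) ¬ch)

    childWeight-pos : ∀ {q x y t} → t < childWeight q x y → Child q x y
    childWeight-pos {q} {x} {y} = positive (child? q x y)
      where positive : ∀ {t} (ch? : Dec (Child q x y)) → t < (if does ch? then β x y else 0) → Child q x y
            positive (yes ch) _ = ch

    β≤below : ∀ {q x y} → Child q x y → β x y ≤ below q x
    β≤below {q} {x} {y} ch = subst (_≤ below q x) (childWeight-β ch) (≤∑ (childWeight q x) y)

    descend : (Inv : Fin n → Fin n → Set) → (∀ {q x y} → Inv q x → Child q x y → Inv x y) →
              ∀ K {q x} → Inv q x → K ≤ below q x →
              ∃ λ q′ → ∃ λ x′ → Inv q′ x′ × K ≤ below q′ x′ × (∀ {y} → Child q′ x′ y → β x′ y ≤ K)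
    descend Inv inv-child K inv K≤ = go (<-wellFounded _) inv K≤
      where
      go : ∀ {q x} → Acc _<_ (below q x) → Inv q x → K ≤ below q x →
           ∃ λ q′ → ∃ λ x′ → Inv q′ x′ × K ≤ below q′ x′ × (∀ {y} → Child q′ x′ y → β x′ y ≤ K)
      go {q} {x} (acc smaller) inv K≤ with any? (λ y → child? q x y ×-dec K ≤? below x y)
      ... | yes (y , ch , K≤′) =
        go (smaller (subst (_≤ below q x) (β≡1+below (proj₁ ch)) (β≤below ch))) (inv-child inv ch) K≤′
      ... | no stuck = q , x , inv , K≤ , λ {y} ch →
              subst (_≤ K) (sym (β≡1+below (proj₁ ch))) (≰⇒> λ K≤′ → stuck (y , ch , K≤′))

    HasEdge : Graph n → Set
    HasEdge G = ∃ λ i → ∃ λ j → Adj G i j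

    EdgeDisjoint : Graph n → Graph n → Set
    EdgeDisjoint G H = ∀ {i j} → Adj G i j → ¬ Adj H i j

    EdgesIn : (Fin n → Fin n → Set) → Graph n → Set
    EdgesIn R G = ∀ {i j} → Adj G i j → R i j

    unique-pieces : ∀ {Cs} → All HasEdge Cs → AllPairs EdgeDisjoint Cs → Unique Cs
    unique-pieces []                 []       = []
    unique-pieces ((i , j , e) ∷ hs) (d ∷ ds) =
      All.map (λ disj G≡H → disj e (subst (λ G → Adj G i j) G≡H e)) d ∷ unique-pieces hs ds

    branch-hasEdge : ∀ {x y} → A x y → HasEdge (branchGraph x y)
    branch-hasEdge {x} {y} xy = x , y , induced-adj⁺ T (branch? x y) xy (inj₁ refl) (inj₂ (side-self xy))

    branch-edges : ∀ {x y} → EdgesIn (BranchEdge x y) (branchGraph x y)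
    branch-edges {x} {y} e = proj₂ (induced-adj⁻ T (branch? x y) e)

    branches-disjoint : ∀ {x y y′} → A x y → A x y′ → y ≢ y′ → EdgeDisjoint (branchGraph x y) (branchGraph x y′)
    branches-disjoint {x} {y} xy xy′ y≢y′ e e′ =
      y≢y′ (branch-edge-unique xy xy′ (proj₁ (induced-adj⁻ T (branch? x y) e)) (branch-edges e) (branch-edges e′))

    ChildSide : Fin n → Fin n → Fin n → Set
    ChildSide q x z = ∃ λ y → Child q x y × Side x y z

    ChildEdge : Fin n → Fin n → Fin n → Fin n → Set
    ChildEdge q x i j = ∃ λ y → Child q x y × BranchEdge x y i j

    -- The invariant of the recursion.  New and Region confine the added cut vertices and the chosen pieces, which is
    -- what allows selections made in different branches to be combined.
    record Selection (W₀ : SS.Subset n) (New : Fin n → Set) (Region : Fin n → Fin n → Set) (extra t slack : ℕ) :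
                     Set where
      field
        W         : SS.Subset n
        W₀⊆W      : W₀ SS.⊆ W
        new       : ∀ {z} → z SS.∈ W → ¬ z SS.∈ W₀ → New z
        ∣W∣≤      : SS.∣ W ∣ ≤ SS.∣ W₀ ∣ + extra
        pieces    : List (Graph n)
        wSubtrees : All (IsWSubtree T W) pieces
        hasEdges  : All HasEdge pieces
        disjoint  : AllPairs EdgeDisjoint pieces
        inRegion  : All (EdgesIn Region) pieces
        lower     : t < totalEdges pieces
        upper     : totalEdges pieces ≤ t + slack

    relax : ∀ {W₀ New New′ R R′ e t s} → (∀ {z} → New z → New′ z) → (∀ {i j} → R i j → R′ i j) →
            Selection W₀ New R e t s → Selection W₀ New′ R′ e t s
    relax New⊆ R⊆ S = record
      { W = W ; W₀⊆W = W₀⊆W ; new = λ z∈W z∉W₀ → New⊆ (new z∈W z∉W₀) ; ∣W∣≤ = ∣W∣≤ ; pieces = pieces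
      ; wSubtrees = wSubtrees ; hasEdges = hasEdges ; disjoint = disjoint
      ; inRegion = All.map (λ inR {i} {j} e → R⊆ (inR e)) inRegion ; lower = lower ; upper = upper }
      where open Selection S

    add-vertex : ∀ {W₀ New R e t s x} → New x →
                 Selection (W₀ SS.∪ SS.⁅ x ⁆) New R e t s → Selection W₀ New R (suc e) t s
    add-vertex {W₀} {New} {e = e} {x = x} new-x S = record
      { W = S.W ; W₀⊆W = S.W₀⊆W ∘ SSP.x∈p∪q⁺ ∘ inj₁ ; new = new ; ∣W∣≤ = ∣W∣≤ ; pieces = S.pieces
      ; wSubtrees = S.wSubtrees ; hasEdges = S.hasEdges ; disjoint = S.disjoint ; inRegion = S.inRegion
      ; lower = S.lower ; upper = S.upper }
      where
      module S = Selection S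
      new : ∀ {z} → z SS.∈ S.W → ¬ z SS.∈ W₀ → New z
      new {z} z∈W z∉W₀ with z SSP.∈? W₀ SS.∪ SS.⁅ x ⁆
      ... | no z∉ = S.new z∈W z∉
      ... | yes z∈ with SSP.x∈p∪q⁻ W₀ SS.⁅ x ⁆ z∈
      ...   | inj₁ z∈W₀ = ⊥-elim (z∉W₀ z∈W₀)
      ...   | inj₂ z∈x  = subst New (sym (SSP.x∈⁅y⁆⇒x≡y x z∈x)) new-x
      ∣W∣≤ : SS.∣ S.W ∣ ≤ SS.∣ W₀ ∣ + suc e
      ∣W∣≤ = begin
        SS.∣ S.W ∣                         ≤⟨ S.∣W∣≤ ⟩
        SS.∣ W₀ SS.∪ SS.⁅ x ⁆ ∣ + e         ≤⟨ +-monoˡ-≤ e (∣p∪q∣≤∣p∣+∣q∣ W₀ SS.⁅ x ⁆) ⟩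
        SS.∣ W₀ ∣ + SS.∣ SS.⁅ x ⁆ ∣ + e     ≡⟨ cong (λ m → SS.∣ W₀ ∣ + m + e) (SSP.∣⁅x⁆∣≡1 x) ⟩
        SS.∣ W₀ ∣ + 1 + e                  ≡⟨ +-assoc SS.∣ W₀ ∣ 1 e ⟩
        SS.∣ W₀ ∣ + suc e                  ∎
        where open ≤-Reasoning

    select-branch : ∀ {W₀ p c k t s} → A p c → p SS.∈ W₀ → (∀ {z} → z SS.∈ W₀ → ¬ Side p c z) →
                    t < β p c → β p c ≤ t + s → Selection W₀ (Side p c) (BranchEdge p c) k t s
    select-branch {W₀} {p} {c} {k} {t} {s} pc p∈W₀ W₀∩side t< β≤ = record
      { W = W₀ ; W₀⊆W = id ; new = λ z∈ z∉ → ⊥-elim (z∉ z∈) ; ∣W∣≤ = m≤m+n _ k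
      ; pieces    = branchGraph p c ∷ []
      ; wSubtrees = branch-isWSubtree W₀ pc p∈W₀ W₀∩side ∷ []
      ; hasEdges  = branch-hasEdge pc ∷ []
      ; disjoint  = [] ∷ []
      ; inRegion  = branch-edges ∷ []
      ; lower     = subst (t <_) (sym (+-identityʳ _)) t<
      ; upper     = subst (_≤ t + s) (sym (+-identityʳ _)) β≤
      }

    childBranches : Fin n → Fin n → List (Fin n) → List (Graph n)
    childBranches q x []       = []
    childBranches q x (y ∷ ys) with child? q x y
    ... | yes _ = branchGraph x y ∷ childBranches q x ys
    ... | no _  = childBranches q x ys

    totalEdges-childBranches : ∀ q x ys → totalEdges (childBranches q x ys) ≡ sum (map (childWeight q x) ys)
    totalEdges-childBranches q x []       = refl
    totalEdges-childBranches q x (y ∷ ys) with child? q x y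
    ... | yes ch  = cong₂ _+_ (sym (childWeight-β ch)) (totalEdges-childBranches q x ys)
    ... | no ¬ch  = trans (totalEdges-childBranches q x ys) (cong (_+ _) (sym (childWeight-0 ¬ch)))

    All-childBranches : ∀ {P : Graph n → Set} q x ys → (∀ {y} → y ∈ ys → Child q x y → P (branchGraph x y)) →
                        All P (childBranches q x ys)
    All-childBranches q x []       _ = []
    All-childBranches q x (y ∷ ys) f with child? q x y
    ... | yes ch = f (hd refl) ch ∷ All-childBranches q x ys (f ∘ tl)
    ... | no _   = All-childBranches q x ys (f ∘ tl)

    disjoint-childBranches : ∀ q x ys → Unique ys → AllPairs EdgeDisjoint (childBranches q x ys)
    disjoint-childBranches q x []       _          = []
    disjoint-childBranches q x (y ∷ ys) (y∉ ∷ uys) with child? q x y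
    ... | yes (xy , _) = All-childBranches q x ys (λ m (xy′ , _) → branches-disjoint xy xy′ (All.lookup y∉ m))
                         ∷ disjoint-childBranches q x ys uys
    ... | no _         = disjoint-childBranches q x ys uys

    with-children : ∀ {q x y₀ W₀ k t s} pre → Unique pre → y₀ ∉ pre → Child q x y₀ → x SS.∈ W₀ →
                    (∀ {z y} → z SS.∈ W₀ → Child q x y → ¬ Side x y z) →
                    Selection W₀ (Side x y₀) (BranchEdge x y₀) k t s →
                    Selection W₀ (ChildSide q x) (ChildEdge q x) k (sum (map (childWeight q x) pre) + t) s
    with-children {q} {x} {y₀} {W₀} {k} {t} {s} pre unique-pre y₀∉pre ch₀ x∈W₀ W₀∩sides R = record
      { W = R.W ; W₀⊆W = R.W₀⊆W ; new = λ z∈ z∉ → y₀ , ch₀ , R.new z∈ z∉ ; ∣W∣≤ = R.∣W∣≤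
      ; pieces    = childBranches q x pre ++ R.pieces
      ; wSubtrees = AllP.++⁺ (All-childBranches q x pre λ y∈ ch →
                      branch-isWSubtree R.W (proj₁ ch) (R.W₀⊆W x∈W₀) (W∩side y∈ ch)) R.wSubtrees
      ; hasEdges  = AllP.++⁺ (All-childBranches q x pre λ _ ch → branch-hasEdge (proj₁ ch)) R.hasEdges
      ; disjoint  = AllPairsP.++⁺ (disjoint-childBranches q x pre unique-pre) R.disjoint cross
      ; inRegion  = AllP.++⁺ (All-childBranches q x pre λ {y} _ ch {i} {j} e → y , ch , branch-edges e)
                             (All.map (λ inR {i} {j} e → y₀ , ch₀ , inR e) R.inRegion)
      ; lower     = subst (_ <_) (sym total) (+-monoʳ-< P R.lower)
      ; upper     = subst₂ _≤_ (sym total) (sym (+-assoc P t s)) (+-monoʳ-≤ P R.upper)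
      }
      where
      module R = Selection R
      P : ℕ
      P = sum (map (childWeight q x) pre)
      total : totalEdges (childBranches q x pre ++ R.pieces) ≡ P + totalEdges R.pieces
      total = trans (totalEdges-++ (childBranches q x pre) R.pieces)
                    (cong (_+ totalEdges R.pieces) (totalEdges-childBranches q x pre))
      W∩side : ∀ {y} → y ∈ pre → Child q x y → ∀ {z} → z SS.∈ R.W → ¬ Side x y z
      W∩side y∈ ch {z} z∈ yz with z SSP.∈? W₀
      ... | yes z∈W₀ = W₀∩sides z∈W₀ ch yz
      ... | no z∉W₀  = y₀∉pre (subst (_∈ pre) (side-unique (proj₁ ch) (proj₁ ch₀) yz (R.new z∈ z∉W₀)) y∈)
      cross : All (λ G → All (EdgeDisjoint G) R.pieces) (childBranches q x pre)
      cross = All-childBranches q x pre λ {y} y∈ ch → All.map (λ inR {i} {j} e e′ →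
                y₀∉pre (subst (_∈ pre) (branch-edge-unique (proj₁ ch) (proj₁ ch₀)
                  (proj₁ (induced-adj⁻ T (branch? x y) e)) (branch-edges e) (inR e′)) y∈)) R.inRegion

    BranchSelector : ℕ → Set
    BranchSelector k = ∀ {p c} W₀ t s → A p c → p SS.∈ W₀ → (∀ {z} → z SS.∈ W₀ → ¬ Side p c z) → t < β p c →
                       ⌈ β p c /2^ k ⌉ ≤ s → Selection W₀ (Side p c) (BranchEdge p c) k t s

    select-children : ∀ {k} → BranchSelector k → ∀ {q x} W₀ t s → x SS.∈ W₀ →
                      (∀ {z y} → z SS.∈ W₀ → Child q x y → ¬ Side x y z) → t < below q x →
                      (∀ {y} → Child q x y → ⌈ β x y /2^ k ⌉ ≤ s) →
                      Selection W₀ (ChildSide q x) (ChildEdge q x) k t s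
    select-children select {q} {x} W₀ t s x∈W₀ W₀∩sides t< small
      with greedy-split (childWeight q x) t (allFin n) t<
    ... | pre , y₀ , _ , t′ , allFin≡ , refl , t′< =
      with-children pre (proj₁ split) (proj₂ split) ch₀ x∈W₀ W₀∩sides
        (select W₀ t′ s (proj₁ ch₀) x∈W₀ (λ z∈ → W₀∩sides z∈ ch₀) (subst (t′ <_) (childWeight-β ch₀) t′<) (small ch₀))
      where
      ch₀ : Child q x y₀
      ch₀ = childWeight-pos t′<
      split : Unique pre × y₀ ∉ pre
      split = Unique-++-∷⁻ pre (subst Unique allFin≡ (allFin⁺ n))

    module _ {p c q x} (I : Inside p c q x) where
      open Inside I

      childSide⊆side : ∀ {z} → ChildSide q x z → Side p c z
      childSide⊆side (y , ch , yz) with child-branch⊆branch I ch (inj₂ yz)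
      ... | inj₁ refl = ⊥-elim (p∉child-side I ch yz)
      ... | inj₂ cz   = cz

      childEdge⊆branchEdge : ∀ {i j} → ChildEdge q x i j → BranchEdge p c i j
      childEdge⊆branchEdge (y , ch , bi , bj) = child-branch⊆branch I ch bi , child-branch⊆branch I ch bj

      with-trunk : ∀ {W₀ e t s} → p SS.∈ W₀ → x SS.∈ W₀ → (∀ {z} → z SS.∈ W₀ → ¬ Reach (Avoiding p x) c z) →
                   Selection W₀ (ChildSide q x) (ChildEdge q x) e t s →
                   Selection W₀ (Side p c) (BranchEdge p c) e (edgeCount (trunkGraph I) + t) s
      with-trunk {W₀} {e} {t} {s} p∈W₀ x∈W₀ W₀∩inner S = record
        { W = S.W ; W₀⊆W = S.W₀⊆W ; new = λ z∈ z∉ → childSide⊆side (S.new z∈ z∉) ; ∣W∣≤ = S.∣W∣≤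
        ; pieces    = trunkGraph I ∷ S.pieces
        ; wSubtrees = trunk-isWSubtree I S.W (S.W₀⊆W p∈W₀) (S.W₀⊆W x∈W₀) W∩inner ∷ S.wSubtrees
        ; hasEdges  = (p , c , induced-adj⁺ T (trunk? I) pc (inj₁ refl) (c∈trunk I)) ∷ S.hasEdges
        ; disjoint  = All.map (λ inR {i} {j} e e′ → trunk∩child-edge e (inR e′)) S.inRegion ∷ S.disjoint
        ; inRegion  = (λ e → let _ , ti , tj = induced-adj⁻ T (trunk? I) e in trunk⊆branch I ti , trunk⊆branch I tj)
                      ∷ All.map (λ inR {i} {j} e → childEdge⊆branchEdge (inR e)) S.inRegion
        ; lower     = +-monoʳ-< a S.lower
        ; upper     = subst (a + totalEdges S.pieces ≤_) (sym (+-assoc a t s)) (+-monoʳ-≤ a S.upper)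
        }
        where
        module S = Selection S
        a : ℕ
        a = edgeCount (trunkGraph I)
        W∩inner : ∀ {z} → z SS.∈ S.W → ¬ Reach (Avoiding p x) c z
        W∩inner {z} z∈ r with z SSP.∈? W₀
        ... | yes z∈W₀ = W₀∩inner z∈W₀ r
        ... | no z∉W₀  = let y , ch , yz = S.new z∈ z∉W₀ in
                         proj₂ (reach-end r) (trunk∩child-branch I ch (inj₂ (inj₂ r)) (inj₂ yz))
        trunk∩child-edge : ∀ {i j} → Adj (trunkGraph I) i j → ¬ ChildEdge q x i j
        trunk∩child-edge e (y , ch , bi , bj) = let ij , ti , tj = induced-adj⁻ T (trunk? I) e in
          adj⇒≢ ij (trans (trunk∩child-branch I ch ti bi) (sym (trunk∩child-branch I ch tj bj)))

      trunk≤below : ⌈ β p c /2⌉ ≤ below q x → edgeCount (trunkGraph I) ≤ below q x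
      trunk≤below half≤ = ≤-trans (+-cancelʳ-≤ (below q x) _ ⌊ β p c /2⌋ (begin
        edgeCount (trunkGraph I) + below q x  ≡⟨ β≡trunk+below I ⟨
        β p c                                 ≡⟨ ⌊n/2⌋+⌈n/2⌉≡n (β p c) ⟨
        ⌊ β p c /2⌋ + ⌈ β p c /2⌉             ≤⟨ +-monoʳ-≤ ⌊ β p c /2⌋ half≤ ⟩
        ⌊ β p c /2⌋ + below q x               ∎)) (≤-trans (⌊n/2⌋≤⌈n/2⌉ (β p c)) half≤)
        where open ≤-Reasoning

      cut-at-x : ∀ {W₀} → (∀ {z} → z SS.∈ W₀ → ¬ Side p c z) → ∀ {z} → z SS.∈ W₀ SS.∪ SS.⁅ x ⁆ →
                 (∀ {y} → Child q x y → ¬ Side x y z) × ¬ Reach (Avoiding p x) c z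
      cut-at-x {W₀} W₀∩side {z} z∈ with SSP.x∈p∪q⁻ W₀ SS.⁅ x ⁆ z∈
      ... | inj₁ z∈W₀ = (λ ch yz → W₀∩side z∈W₀ (childSide⊆side (_ , ch , yz))) , W₀∩side z∈W₀ ∘ proj₁ ∘ trunk-sides I
      ... | inj₂ z∈x with SSP.x∈⁅y⁆⇒x≡y x z∈x
      ...   | refl = (λ _ yz → reach-end yz refl) , λ r → proj₂ (reach-end r) refl

    select-at : ∀ {k} → BranchSelector k → ∀ {p c q x} → Inside p c q x → ∀ W₀ t s → p SS.∈ W₀ →
                (∀ {z} → z SS.∈ W₀ → ¬ Side p c z) → t < β p c → ⌈ β p c /2⌉ ≤ below q x →
                (∀ {y} → Child q x y → β x y ≤ ⌈ β p c /2⌉) → ⌈ β p c /2^ suc k ⌉ ≤ s →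
                Selection W₀ (Side p c) (BranchEdge p c) (suc k) t s
    select-at {k} select {p} {c} {q} {x} I W₀ t s p∈W₀ W₀∩side t< half≤ small slack =
      add-vertex (Inside.cx I) (choose (a ≤? t))
      where
      a : ℕ
      a = edgeCount (trunkGraph I)
      W₀′ : SS.Subset n
      W₀′ = W₀ SS.∪ SS.⁅ x ⁆
      children : ∀ t′ → t′ < below q x → Selection W₀′ (ChildSide q x) (ChildEdge q x) k t′ s
      children t′ t′< = select-children select W₀′ t′ s (SSP.x∈p∪q⁺ (inj₂ (SSP.x∈⁅x⁆ x)))
        (λ z∈ → proj₁ (cut-at-x I W₀∩side z∈)) t′< (λ ch → ≤-trans (⌈/2^⌉-mono k (small ch)) slack)
      choose : Dec (a ≤ t) → Selection W₀′ (Side p c) (BranchEdge p c) k t s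
      choose (yes a≤t) with m≤n⇒∃[o]m+o≡n a≤t
      ... | t′ , refl = with-trunk I (SSP.x∈p∪q⁺ (inj₁ p∈W₀)) (SSP.x∈p∪q⁺ (inj₂ (SSP.x∈⁅x⁆ x)))
                          (λ z∈ → proj₂ (cut-at-x I W₀∩side z∈))
                          (children t′ (+-cancelˡ-< a _ _ (subst (a + t′ <_) (β≡trunk+below I) t<)))
      choose (no a≰t) = relax (childSide⊆side I) (childEdge⊆branchEdge I)
                              (children t (<-≤-trans (≰⇒> a≰t) (trunk≤below I half≤)))

    select-step : ∀ {k} → BranchSelector k → BranchSelector (suc k)
    select-step {k} select {p} {c} W₀ t s pc p∈W₀ W₀∩side t< slack with below p c in below≡
    ... | zero  = select-branch pc p∈W₀ W₀∩side t< (subst (_≤ t + s) (sym β≡1) (≤-trans one≤s (m≤n+m s t)))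
      where
      β≡1 : β p c ≡ 1
      β≡1 = trans (β≡1+below pc) (cong suc below≡)
      one≤s : 1 ≤ s
      one≤s = subst (_≤ s) (trans (cong (λ b → ⌈ b /2^ suc k ⌉) β≡1) (⌈1/2^k⌉≡1 k)) slack
    ... | suc m with descend (Inside p c) inside-child ⌈ β p c /2⌉ (inside-root pc) half≤
      where half≤ : ⌈ β p c /2⌉ ≤ below p c
            half≤ = subst₂ (λ b m → ⌈ b /2⌉ ≤ m) (sym (trans (β≡1+below pc) (cong suc below≡))) (sym below≡)
                      (≤-pred (⌈n/2⌉<n m))
    ...   | q , x , I , half≤below , small = select-at select I W₀ t s p∈W₀ W₀∩side t< half≤below small slack

    select : ∀ k → BranchSelector k
    select zero    W₀ t s pc p∈W₀ W₀∩side t< β≤s = select-branch pc p∈W₀ W₀∩side t< (≤-trans β≤s (m≤n+m s t))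
    select (suc k) = select-step (select k)

    select-tree : ∀ w t₀ → t₀ < edgeCount T →
                  ∃ λ W → SS.∣ W ∣ ≤ suc w × ∃ λ C → Unique C × All (IsWSubtree T W) C ×
                    t₀ < totalEdges C × (totalEdges C ≡ suc t₀ ⊎ totalEdges C ≤ t₀ + ⌈ t₀ /2^ w ⌉)
    select-tree w t₀ t₀< with nonempty
    ... | r , _ with descend (λ _ _ → ⊤) (λ _ _ → tt) (suc t₀) {r} {r} tt (subst (suc t₀ ≤_) (edgeCount≡below r) t₀<)
    ...   | q , x , _ , t₀<below , small with any? (λ y → child? q x y ×-dec suc t₀ ≤? β x y)
    ...     | yes (y , ch , big) =
      SS.⁅ x ⁆ , ≤-trans (≤-reflexive (SSP.∣⁅x⁆∣≡1 x)) (s≤s z≤n) , branchGraph x y ∷ [] , [] ∷ [] ,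
      branch-isWSubtree SS.⁅ x ⁆ (proj₁ ch) (SSP.x∈⁅x⁆ x) (λ z∈ r → reach-end r (SSP.x∈⁅y⁆⇒x≡y x z∈)) ∷ [] ,
      subst (t₀ <_) (sym (+-identityʳ _)) big , inj₁ (trans (+-identityʳ _) (≤-antisym (small ch) big))
    ...     | no none = S.W , subst (λ m → SS.∣ S.W ∣ ≤ m + w) (SSP.∣⁅x⁆∣≡1 x) S.∣W∣≤ , S.pieces ,
                        unique-pieces S.hasEdges S.disjoint , S.wSubtrees , S.lower , inj₂ S.upper
      where
      S : Selection SS.⁅ x ⁆ (ChildSide q x) (ChildEdge q x) w t₀ ⌈ t₀ /2^ w ⌉
      S = select-children (select w) SS.⁅ x ⁆ t₀ ⌈ t₀ /2^ w ⌉ (SSP.x∈⁅x⁆ x)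
                          (λ z∈ _ r → reach-end r (SSP.x∈⁅y⁆⇒x≡y x z∈))
                          t₀<below λ {y} ch → ⌈/2^⌉-mono w (≤-pred (≰⇒> λ big → none (y , ch , big)))
      module S = Selection S


open import Data.Nat using (ℕ; suc)
open import Data.Integer using (+_)
open import Data.Rational using (ℚ; _/_; _≤_; _<_; _+_; _*_; 1ℚ)
open import Data.Fin.Subset using (Subset; ⊤; ∣_∣)
open import Data.List using (List)
open import Data.List.Relation.Unary.All using (All)
open import Data.List.Relation.Unary.Unique.Propositional using (Unique)
open import Data.Product using (Σ; _×_)
open import Relation.Binary.PropositionalEquality using (_≡_)

open import Algebra.Bundles using (CommutativeMonoid)
open import Data.Nat as ℕ using (zero; z≤n; s≤s; ⌈_/2⌉)
import Data.Nat.Properties as ℕ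
import Data.Nat.Coprimality as Coprime
import Data.Integer as ℤ
import Data.Integer.Properties as ℤ
open import Data.Rational using (mkℚ; 0ℚ; *≤*; nonNegative; _≤?_)
import Data.Rational.Properties as ℚ
open import Algebra.Properties.CommutativeSemigroup (CommutativeMonoid.commutativeSemigroup ℚ.*-1-commutativeMonoid)
  using (x∙yz≈y∙xz)
open import Data.Product using (∃; _,_)
open import Data.Sum using (_⊎_; inj₁; inj₂)
open import Data.Empty using (⊥-elim)
open import Relation.Binary.PropositionalEquality
  using (refl; sym; trans; cong; cong₂; subst; subst₂; module ≡-Reasoning)
open import Relation.Nullary using (Dec; yes; no)
open import Relation.Nullary.Decidable using (toWitness)
open Combinatorial using (⌈_/2^_⌉; module Tree)

-- Rational estimates

fromℕ : ℕ → ℚ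
fromℕ m = + m / 1

fromℕ≡mkℚ : ∀ m → fromℕ m ≡ mkℚ (+ m) 0 (Coprime.sym (Coprime.1-coprimeTo m))
fromℕ≡mkℚ m = ℚ.normalize-coprime (Coprime.sym (Coprime.1-coprimeTo m))

fromℕ-+ : ∀ a b → fromℕ (a ℕ.+ b) ≡ fromℕ a + fromℕ b
fromℕ-+ a b rewrite fromℕ≡mkℚ a | fromℕ≡mkℚ b =
  cong (_/ 1) (sym (cong₂ ℤ._+_ (ℤ.*-identityʳ (+ a)) (ℤ.*-identityʳ (+ b))))

fromℕ-* : ∀ a b → fromℕ (a ℕ.* b) ≡ fromℕ a * fromℕ b
fromℕ-* a b rewrite fromℕ≡mkℚ a | fromℕ≡mkℚ b = cong (_/ 1) (ℤ.pos-* a b)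

fromℕ-mono-≤ : ∀ {a b} → a ℕ.≤ b → fromℕ a ≤ fromℕ b
fromℕ-mono-≤ {a} {b} a≤b rewrite fromℕ≡mkℚ a | fromℕ≡mkℚ b =
  *≤* (subst₂ ℤ._≤_ (sym (ℤ.*-identityʳ (+ a))) (sym (ℤ.*-identityʳ (+ b))) (ℤ.+≤+ a≤b))

0≤fromℕ : ∀ m → 0ℚ ≤ fromℕ m
0≤fromℕ m = fromℕ-mono-≤ {0} {m} z≤n

0≤* : ∀ {p q} → 0ℚ ≤ p → 0ℚ ≤ q → 0ℚ ≤ p * q
0≤* {p} {q} 0≤p 0≤q = ℚ.nonNegative⁻¹ _ {{ℚ.nonNeg*nonNeg⇒nonNeg p {{nonNegative 0≤p}} q {{nonNegative 0≤q}}}}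

0≤^ : ∀ {q} k → 0ℚ ≤ q → 0ℚ ≤ q ^ℚ k
0≤^ zero    0≤q = toWitness {a? = 0ℚ ≤? 1ℚ} _
0≤^ (suc k) 0≤q = 0≤* 0≤q (0≤^ k 0≤q)

⅔ : ℚ
⅔ = + 2 / 3

0≤⅔ : 0ℚ ≤ ⅔
0≤⅔ = toWitness {a? = 0ℚ ≤? ⅔} _

⅔^≤1 : ∀ k → ⅔ ^ℚ k ≤ 1ℚ
⅔^≤1 zero    = ℚ.≤-refl
⅔^≤1 (suc k) = ℚ.≤-trans (ℚ.*-monoˡ-≤-nonNeg ⅔ {{nonNegative 0≤⅔}} (⅔^≤1 k)) (toWitness {a? = ⅔ * 1ℚ ≤? 1ℚ} _)

⅔^*3/2^≡1 : ∀ k → ⅔ ^ℚ k * (+ 3 / 2) ^ℚ k ≡ 1ℚ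
⅔^*3/2^≡1 zero    = refl
⅔^*3/2^≡1 (suc k) = begin
  (⅔ * ⅔ ^ℚ k) * ((+ 3 / 2) * (+ 3 / 2) ^ℚ k) ≡⟨ ℚ.*-assoc ⅔ (⅔ ^ℚ k) ((+ 3 / 2) * (+ 3 / 2) ^ℚ k) ⟩
  ⅔ * (⅔ ^ℚ k * ((+ 3 / 2) * (+ 3 / 2) ^ℚ k)) ≡⟨ cong (⅔ *_) (x∙yz≈y∙xz (⅔ ^ℚ k) (+ 3 / 2) ((+ 3 / 2) ^ℚ k)) ⟩
  ⅔ * ((+ 3 / 2) * (⅔ ^ℚ k * (+ 3 / 2) ^ℚ k)) ≡⟨ cong (λ r → ⅔ * ((+ 3 / 2) * r)) (⅔^*3/2^≡1 k) ⟩
  ⅔ * ((+ 3 / 2) * 1ℚ)                        ≡⟨⟩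
  1ℚ                                           ∎
  where open ≡-Reasoning

3⌈n/2⌉≤2n : ∀ n → 3 ℕ.≤ n → 3 ℕ.* ⌈ n /2⌉ ℕ.≤ 2 ℕ.* n
3⌈n/2⌉≤2n 1               (s≤s ())
3⌈n/2⌉≤2n 2               (s≤s (s≤s ()))
3⌈n/2⌉≤2n 3               _ = ℕ.≤-refl
3⌈n/2⌉≤2n 4               _ = ℕ.m≤m+n 6 2
3⌈n/2⌉≤2n (suc (suc n@(suc (suc (suc _))))) _ =
  subst₂ ℕ._≤_ (sym (ℕ.*-suc 3 ⌈ n /2⌉)) (sym (trans (ℕ.*-suc 2 (suc n)) (cong (2 ℕ.+_) (ℕ.*-suc 2 n))))
    (ℕ.+-mono-≤ (ℕ.n≤1+n 3) (3⌈n/2⌉≤2n n (s≤s (s≤s (s≤s z≤n)))))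

⌈n/2⌉≤⅔n : ∀ n → 3 ℕ.≤ n → fromℕ ⌈ n /2⌉ ≤ ⅔ * fromℕ n
⌈n/2⌉≤⅔n n 3≤n = ℚ.*-cancelˡ-≤-pos (fromℕ 3) (subst₂ _≤_ (fromℕ-* 3 ⌈ n /2⌉)
  (trans (fromℕ-* 2 n) (ℚ.*-assoc (fromℕ 3) ⅔ (fromℕ n))) (fromℕ-mono-≤ (3⌈n/2⌉≤2n n 3≤n)))

⌈/2^⌉-bound : ∀ k d α → fromℕ d ≤ α → 1ℚ ≤ ⅔ ^ℚ k * α → fromℕ ⌈ d /2^ k ⌉ ≤ ⅔ ^ℚ k * α
⌈/2^⌉-bound zero    d α d≤α _  = subst (fromℕ d ≤_) (sym (ℚ.*-identityˡ α)) d≤α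
⌈/2^⌉-bound (suc k) d α d≤α 1≤ =
  subst (fromℕ ⌈ d /2^ suc k ⌉ ≤_) reassoc (⌈/2^⌉-bound k ⌈ d /2⌉ (⅔ * α) half≤ (subst (1ℚ ≤_) (sym reassoc) 1≤))
  where
  reassoc : ⅔ ^ℚ k * (⅔ * α) ≡ ⅔ ^ℚ suc k * α
  reassoc = trans (x∙yz≈y∙xz (⅔ ^ℚ k) ⅔ α) (sym (ℚ.*-assoc ⅔ (⅔ ^ℚ k) α))
  0≤⅔α : 0ℚ ≤ ⅔ * α
  0≤⅔α = 0≤* 0≤⅔ (ℚ.≤-trans (0≤fromℕ d) d≤α)
  half≤ : fromℕ ⌈ d /2⌉ ≤ ⅔ * α
  half≤ with 3 ℕ.≤? d
  ... | yes 3≤d = ℚ.≤-trans (⌈n/2⌉≤⅔n d 3≤d) (ℚ.*-monoˡ-≤-nonNeg ⅔ {{nonNegative 0≤⅔}} d≤α)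
  ... | no 3≰d  = begin
    fromℕ ⌈ d /2⌉      ≤⟨ fromℕ-mono-≤ (ℕ.⌈n/2⌉-mono {d} {2} (ℕ.≤-pred (ℕ.≰⇒> 3≰d))) ⟩
    1ℚ                 ≤⟨ 1≤ ⟩
    ⅔ ^ℚ suc k * α     ≡⟨ reassoc ⟨
    ⅔ ^ℚ k * (⅔ * α)   ≤⟨ ℚ.*-monoʳ-≤-nonNeg (⅔ * α) {{nonNegative 0≤⅔α}} (⅔^≤1 k) ⟩
    1ℚ * (⅔ * α)       ≡⟨ ℚ.*-identityˡ (⅔ * α) ⟩
    ⅔ * α              ∎
    where open ℚ.≤-Reasoning

floor-below : ∀ α → 0ℚ ≤ α → ∀ m → α < fromℕ m → ∃ λ t₀ → t₀ ℕ.< m × fromℕ t₀ ≤ α × α < fromℕ (suc t₀)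
floor-below α 0≤α zero    α<0   = ⊥-elim (ℚ.<-irrefl refl (ℚ.<-≤-trans α<0 0≤α))
floor-below α 0≤α (suc m) α<1+m = below (fromℕ m ≤? α)
  where
  below : Dec (fromℕ m ≤ α) → ∃ λ t₀ → t₀ ℕ.< suc m × fromℕ t₀ ≤ α × α < fromℕ (suc t₀)
  below (yes m≤α) = m , ℕ.≤-refl , m≤α , α<1+m
  below (no m≰α)  = let t₀ , t₀<m , t₀≤α , α<1+t₀ = floor-below α 0≤α m (ℚ.≰⇒> m≰α) in
                    t₀ , ℕ.m≤n⇒m≤1+n t₀<m , t₀≤α , α<1+t₀

0≤3·3/2^ : ∀ w → 0ℚ ≤ (+ 3 / 1) * ((+ 3 / 2) ^ℚ w)
0≤3·3/2^ w = 0≤* (toWitness {a? = 0ℚ ≤? (+ 3 / 1)} _) (0≤^ w (toWitness {a? = 0ℚ ≤? (+ 3 / 2)} _))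

1≤⅔^*α : ∀ w α → (+ 3 / 1) * ((+ 3 / 2) ^ℚ w) ≤ α → 1ℚ ≤ ⅔ ^ℚ w * α
1≤⅔^*α w α 3·3/2^≤α = begin
  1ℚ                                          ≤⟨ toWitness {a? = 1ℚ ≤? (+ 3 / 1)} _ ⟩
  + 3 / 1                                     ≡⟨ cong (+ 3 / 1 *_) (⅔^*3/2^≡1 w) ⟨
  + 3 / 1 * (⅔ ^ℚ w * (+ 3 / 2) ^ℚ w)         ≡⟨ x∙yz≈y∙xz (+ 3 / 1) (⅔ ^ℚ w) ((+ 3 / 2) ^ℚ w) ⟩
  ⅔ ^ℚ w * (+ 3 / 1 * (+ 3 / 2) ^ℚ w)         ≤⟨ ℚ.*-monoˡ-≤-nonNeg (⅔ ^ℚ w) {{nonNegative (0≤^ w 0≤⅔)}} 3·3/2^≤α ⟩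
  ⅔ ^ℚ w * α                                  ∎
  where open ℚ.≤-Reasoning

total-bound : ∀ w α t₀ {N} → (+ 3 / 1) * ((+ 3 / 2) ^ℚ w) ≤ α → fromℕ t₀ ≤ α →
         N ≡ suc t₀ ⊎ N ℕ.≤ t₀ ℕ.+ ⌈ t₀ /2^ w ⌉ → fromℕ N ≤ (1ℚ + ⅔ ^ℚ w) * α
total-bound w α t₀ {N} 3·3/2^≤α t₀≤α N≤ = let m , N≤t₀+m , m≤ = overshoot N≤ in begin
  fromℕ N                ≤⟨ fromℕ-mono-≤ N≤t₀+m ⟩
  fromℕ (t₀ ℕ.+ m)       ≡⟨ fromℕ-+ t₀ m ⟩
  fromℕ t₀ + fromℕ m     ≤⟨ ℚ.+-mono-≤ t₀≤α m≤ ⟩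
  α + ⅔ ^ℚ w * α         ≡⟨ cong (_+ ⅔ ^ℚ w * α) (ℚ.*-identityˡ α) ⟨
  1ℚ * α + ⅔ ^ℚ w * α    ≡⟨ ℚ.*-distribʳ-+ α 1ℚ (⅔ ^ℚ w) ⟨
  (1ℚ + ⅔ ^ℚ w) * α      ∎
  where
  open ℚ.≤-Reasoning
  overshoot : N ≡ suc t₀ ⊎ N ℕ.≤ t₀ ℕ.+ ⌈ t₀ /2^ w ⌉ → ∃ λ m → N ℕ.≤ t₀ ℕ.+ m × fromℕ m ≤ ⅔ ^ℚ w * α
  overshoot (inj₁ N≡1+t₀) = 1 , ℕ.≤-reflexive (trans N≡1+t₀ (ℕ.+-comm 1 t₀)) , 1≤⅔^*α w α 3·3/2^≤α
  overshoot (inj₂ N≤t₀+)  = ⌈ t₀ /2^ w ⌉ , N≤t₀+ , ⌈/2^⌉-bound w t₀ α t₀≤α (1≤⅔^*α w α 3·3/2^≤α)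

lemma3p1 : (w : ℕ) (α : ℚ) → (+ 3 / 1) * ((+ 3 / 2) ^ℚ w) ≤ α →
           (n : ℕ) (T : Graph n) → IsTree T → verts T ≡ ⊤ →
           α < (+ edgeCount T / 1) →
           Σ (Subset n) λ W → (∣ W ∣ Data.Nat.≤ suc w) ×
             Σ (List (Graph n)) λ 𝒞 → Unique 𝒞 × All (IsWSubtree T W) 𝒞 ×
               (α < (+ totalEdges 𝒞 / 1)) ×
               ((+ totalEdges 𝒞 / 1) ≤ (1ℚ + ((+ 2 / 3) ^ℚ w)) * α)
lemma3p1 w α 3·3/2^≤α n T isT spanning α<E =
  let t₀ , t₀<E , t₀≤α , α<1+t₀ = floor-below α (ℚ.≤-trans (0≤3·3/2^ w) 3·3/2^≤α) (edgeCount T) α<E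
      W , ∣W∣≤ , 𝒞 , unique , wSubtrees , t₀<𝒞 , 𝒞≤ = Tree.select-tree T isT spanning w t₀ t₀<E
  in W , ∣W∣≤ , 𝒞 , unique , wSubtrees , ℚ.<-≤-trans α<1+t₀ (fromℕ-mono-≤ t₀<𝒞) , total-bound w α t₀ 3·3/2^≤α t₀≤α 𝒞≤
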